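{- For all integers $m,n\geq 3$, the torus graph $T_{m,n}$ satisfies $\beta_M(T_{m,n})=4$.
   Context: The torus graph $T_{m,n}$ is the Cartesian product $C_m\Box C_n$ of cycles: its vertices are pairs $(i,j)$ with $i\in\{0,\dots,m-1\}$, $j\in\{0,\dots,n-1\}$, and $(i,j)$ is adjacent to $(i\pm1 \bmod m, j)$ and $(i, j\pm1 \bmod n)$. For vertices $u,v$, $d(u,v)$ is the number of edges on a shortest $u$–$v$ path. For a vertex $w$ and an edge $e=uv$, $d(w,e)=\min(d(w,u),d(w,v))$. A vertex $w$ resolves two elements $x,y\in V\cup E$ if $d(w,x)\neq d(w,y)$. A set $S\subseteq V$ is a mixed resolving set if every pair of distinct elements of $V\cup E$ is resolved by some element of $S$. The mixed metric dimension $\beta_M(G)$ is the minimum cardinality of a mixed resolving set of $G$. -}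

module Defs where

open import Data.Nat using (ℕ; zero; suc; _≤_; _⊓_)
open import Data.Fin using (Fin; toℕ)
open import Data.Product using (Σ; ∃; _×_; _,_)
open import Data.Sum using (_⊎_; inj₁; inj₂)
open import Data.Empty using (⊥)
open import Data.List using (List; length)
open import Data.List.Membership.Propositional using (_∈_)
open import Data.List.Relation.Unary.Any using (Any)
open import Data.List.Relation.Unary.Unique.Propositional using (Unique)
open import Relation.Binary.PropositionalEquality using (_≡_)
open import Relation.Nullary using (¬_)

module Graph {V : Set} (Adj : V → V → Set) where

  data Walk : V → V → ℕ → Set where
    here : ∀ {u} → Walk u u 0
    step : ∀ {u w v k} → Adj u w → Walk w v k → Walk u v (suc k)

  Dist : V → V → ℕ → Set
  Dist u v k = Walk u v k × (∀ j → Walk u v j → k ≤ j)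

  Edge : Set
  Edge = Σ V λ u → Σ V λ v → Adj u v

  Elem : Set
  Elem = V ⊎ Edge

  -- when two representatives denote the same element (edges are unordered)
  SameElem : Elem → Elem → Set
  SameElem (inj₁ u) (inj₁ v) = u ≡ v
  SameElem (inj₁ _) (inj₂ _) = ⊥
  SameElem (inj₂ _) (inj₁ _) = ⊥
  SameElem (inj₂ (u , v , _)) (inj₂ (u' , v' , _)) =
    (u ≡ u' × v ≡ v') ⊎ (u ≡ v' × v ≡ u')

  DistE : V → Elem → ℕ → Set
  DistE w (inj₁ u) k = Dist w u k
  DistE w (inj₂ (u , v , _)) k =
    ∃ λ a → ∃ λ b → Dist w u a × Dist w v b × k ≡ a ⊓ b

  Resolves : V → Elem → Elem → Set
  Resolves w x y = ∀ a b → DistE w x a → DistE w y b → ¬ (a ≡ b)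

  MixedResolving : List V → Set
  MixedResolving S =
    ∀ (x y : Elem) → ¬ SameElem x y → Any (λ w → Resolves w x y) S

  MixedMetricDim≡ : ℕ → Set
  MixedMetricDim≡ k =
    (Σ (List V) λ S → Unique S × MixedResolving S × length S ≡ k)
    × (∀ (S : List V) → Unique S → MixedResolving S → k ≤ length S)

-- The cycle C_m on Fin m: a ~ b iff b = a ± 1 (mod m)

CycAdj : (m : ℕ) → Fin m → Fin m → Set
CycAdj m a b =
  suc (toℕ a) ≡ toℕ b ⊎ suc (toℕ b) ≡ toℕ a
  ⊎ (toℕ a ≡ 0 × suc (toℕ b) ≡ m) ⊎ (toℕ b ≡ 0 × suc (toℕ a) ≡ m)

TorusAdj : (m n : ℕ) → Fin m × Fin n → Fin m × Fin n → Set
TorusAdj m n (i , j) (i' , j') =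
  (CycAdj m i i' × j ≡ j') ⊎ (i ≡ i' × CycAdj n j j')

-- A landmark w sees a vertex v and the four edges at v at distance d(w,v) or
-- d(w,v) − 1, and a landmark at v sees all five at distance 0.  So a set of at most three
-- landmarks, one of them v, gives these five elements at most 2² distance vectors.
--
-- Write m = 2k + r with r ≤ 1 and t = k + r (likewise for n), and take the
-- landmarks (1,0), (1,t), (0,1), (t,1).  Torus distances add over the two cycles, and a torus
-- element projects to a point or an edge of each cycle, an edge in at most one of them.  The
-- landmarks (1,0) and (1,t) share their first coordinate, so together they fix d(0,Y) − d(t,Y)
-- for the second projection Y; similarly (0,1) and (t,1) fix d(0,X) − d(t,X).  By a parity
-- count, two elements of a cycle with the same such difference are equal, or equally far from 0
-- but at different distances from 1, or a point and an edge whose distances to 0 and to 1 are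
-- shifted by one in opposite directions.  The equations for (1,0) and (0,1) then leave only
-- equality in both coordinates.

module Submission where

open import Defs
open import Data.Nat
  using (ℕ; zero; suc; pred; _+_; _∸_; _≤_; _<_; _≤?_; _<?_; _⊓_; _≟_; ∣_-_∣; z≤n; s≤s; s≤s⁻¹; >-nonZero)
open import Data.Nat.Properties
open import Data.Nat.Tactic.RingSolver using (solve)
open import Data.Fin using (Fin; toℕ; fromℕ; fromℕ<; inject₁; combine)
import Data.Fin as Fin
open import Data.Fin.Patterns using (0F; 1F; 2F; 3F)
open import Data.Fin.Properties
  using (toℕ-injective; toℕ-fromℕ; toℕ-fromℕ<; toℕ-inject₁; toℕ<n; pigeonhole; combine-injective)
  renaming (<⇒≢ to <⇒≢ᶠ)
open import Data.Product using (Σ; ∃; ∃₂; _×_; _,_; proj₁; proj₂)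
open import Data.Product.Properties using (,-injectiveˡ; ,-injectiveʳ)
open import Data.Sum using (_⊎_; inj₁; inj₂)
open import Data.Unit using (⊤; tt)
open import Data.Empty using (⊥; ⊥-elim)
open import Data.List using (List; []; _∷_; length)
open import Data.List.Relation.Unary.Any as Any using (here; there; any?)
open import Data.List.Relation.Unary.All as All using (All)
open import Data.List.Relation.Unary.All.Properties using (¬Any⇒All¬)
import Data.List.Relation.Unary.AllPairs as AllPairs
open import Data.List.Relation.Unary.Unique.Propositional using (Unique)
open import Relation.Binary.PropositionalEquality
open import Relation.Nullary using (¬_; Dec; yes; no; contradiction)
open import Relation.Nullary.Decidable using (¬?; decidable-stable)

-- Walks and distances in a graph

module WalkProperties {V : Set} (Adj : V → V → Set) where
  open Graph Adj

  _▻_ : ∀ {u v w k} → Walk u v k → Adj v w → Walk u w (suc k)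
  here ▻ a = step a here
  step b p ▻ a = step b (p ▻ a)

  _++ʷ_ : ∀ {u v w k l} → Walk u v k → Walk v w l → Walk u w (k + l)
  here ++ʷ q = q
  step a p ++ʷ q = step a (p ++ʷ q)

  reverse : (∀ {u v} → Adj u v → Adj v u) → ∀ {u v k} → Walk u v k → Walk v u k
  reverse sym here = here
  reverse sym (step a p) = reverse sym p ▻ sym a

  castʷ : ∀ {u v k l} → k ≡ l → Walk u v k → Walk u v l
  castʷ refl p = p

  shorter : ∀ {u v k l} → Walk u v k → Walk u v l → Walk u v (k ⊓ l)
  shorter {k = k} {l} p q with ⊓-sel k l
  ... | inj₁ k⊓l≡k = castʷ (sym k⊓l≡k) p
  ... | inj₂ k⊓l≡l = castʷ (sym k⊓l≡l) q

  Dist-unique : ∀ {u v k l} → Dist u v k → Dist u v l → k ≡ l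
  Dist-unique (p , p-min) (q , q-min) = ≤-antisym (p-min _ q) (q-min _ p)

  potential≤length : (F : V → ℕ) → (∀ {a b} → Adj a b → F a ≤ suc (F b)) →
                     ∀ {a b k} → Walk a b k → F a ≤ F b + k
  potential≤length F F-lip {a} here = ≤-reflexive (sym (+-identityʳ (F a)))
  potential≤length F F-lip {b = b} (step {k = k} x p) = begin
    F _             ≤⟨ F-lip x ⟩
    suc (F _)       ≤⟨ s≤s (potential≤length F F-lip p) ⟩
    suc (F b + k)   ≡⟨ +-suc (F b) k ⟨
    F b + suc k     ∎
    where open ≤-Reasoning

IsDistance : {V : Set} → (V → V → Set) → (V → V → ℕ) → Set
IsDistance Adj d = ∀ u v → Graph.Dist Adj u v (d u v)

module ElementDistance {V : Set} {Adj : V → V → Set}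
    (Adj-sym : ∀ {u v} → Adj u v → Adj v u)
    (d : V → V → ℕ) (d-isDistance : IsDistance Adj d) where
  open Graph Adj
  open WalkProperties Adj

  d-self : ∀ v → d v v ≡ 0
  d-self v = Dist-unique (d-isDistance v v) (here , λ _ _ → z≤n)

  d-lipschitz : ∀ w {u v} → Adj u v → d w v ≤ suc (d w u)
  d-lipschitz w {u} {v} a = proj₂ (d-isDistance w v) _ (proj₁ (d-isDistance w u) ▻ a)

  elemDist : V → Elem → ℕ
  elemDist w (inj₁ u) = d w u
  elemDist w (inj₂ (u , v , _)) = d w u ⊓ d w v

  elemDist-isDistE : ∀ w x → DistE w x (elemDist w x)
  elemDist-isDistE w (inj₁ u) = d-isDistance w u
  elemDist-isDistE w (inj₂ (u , v , _)) = _ , _ , d-isDistance w u , d-isDistance w v , refl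

  DistE-unique : ∀ w x {k} → DistE w x k → k ≡ elemDist w x
  DistE-unique w (inj₁ u) δ = Dist-unique δ (d-isDistance w u)
  DistE-unique w (inj₂ (u , v , _)) (_ , _ , δu , δv , refl) =
    cong₂ _⊓_ (Dist-unique δu (d-isDistance w u)) (Dist-unique δv (d-isDistance w v))

  resolves : ∀ {w x y} → elemDist w x ≢ elemDist w y → Resolves w x y
  resolves {w} {x} {y} ne a b δx δy a≡b =
    ne (trans (sym (DistE-unique w x δx)) (trans a≡b (DistE-unique w y δy)))

  ¬resolves : ∀ {w x y} → elemDist w x ≡ elemDist w y → ¬ Resolves w x y
  ¬resolves {w} {x} {y} eq res = res _ _ (elemDist-isDistE w x) (elemDist-isDistE w y) eq

  resolving-if-separating : ∀ S → (∀ x y → All (λ w → elemDist w x ≡ elemDist w y) S → SameElem x y) →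
                            MixedResolving S
  resolving-if-separating S separates x y ¬same with any? (λ w → ¬? (elemDist w x ≟ elemDist w y)) S
  ... | yes differs = Any.map resolves differs
  ... | no ¬differs = ⊥-elim (¬same (separates x y
          (All.map (decidable-stable (_ ≟ _)) (¬Any⇒All¬ S ¬differs))))

  edgeDist-cases : ∀ w {u v} (a : Adj u v) →
    elemDist w (inj₂ (u , v , a)) ≡ d w u ⊎ elemDist w (inj₂ (u , v , a)) ≡ pred (d w u)
  edgeDist-cases w {u} {v} a with ≤-total (d w u) (d w v)
  ... | inj₁ u≤v = inj₁ (m≤n⇒m⊓n≡m u≤v)
  ... | inj₂ v≤u with m≤n⇒m<n∨m≡n (d-lipschitz w (Adj-sym a))
  ...   | inj₁ (s≤s u≤v) = inj₁ (m≤n⇒m⊓n≡m u≤v)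
  ...   | inj₂ u≡1+v = inj₂ (trans (m≥n⇒m⊓n≡n v≤u) (cong pred (sym u≡1+v)))

  bitOf : ∀ {x D : ℕ} → Dec (x ≡ D) → Fin 2
  bitOf (yes _) = 0F
  bitOf (no _) = 1F

  bitOf-injective : ∀ {x y D : ℕ} → (x ≡ D ⊎ x ≡ pred D) → (y ≡ D ⊎ y ≡ pred D) →
                    (p : Dec (x ≡ D)) (q : Dec (y ≡ D)) → bitOf p ≡ bitOf q → x ≡ y
  bitOf-injective _ _ (yes x≡D) (yes y≡D) _ = trans x≡D (sym y≡D)
  bitOf-injective x-cases y-cases (no x≢D) (no y≢D) _ = trans (other x-cases x≢D) (sym (other y-cases y≢D))
    where
    other : ∀ {z D} → z ≡ D ⊎ z ≡ pred D → z ≢ D → z ≡ pred D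
    other (inj₁ z≡D) z≢D = contradiction z≡D z≢D
    other (inj₂ z≡D-1) _ = z≡D-1

  module FourNeighbours
      (irreflexive : ∀ {v} → ¬ Adj v v)
      (nb : V → Fin 4 → V) (nb-adj : ∀ v i → Adj v (nb v i))
      (nb-injective : ∀ v {i j} → nb v i ≡ nb v j → i ≡ j) where

    star : V → Fin 5 → Elem
    star v 0F = inj₁ v
    star v (Fin.suc i) = inj₂ (v , nb v i , nb-adj v i)

    star-injective : ∀ v {i j} → SameElem (star v i) (star v j) → i ≡ j
    star-injective v {0F} {0F} _ = refl
    star-injective v {Fin.suc i} {Fin.suc j} (inj₁ (_ , same)) = cong Fin.suc (nb-injective v same)
    star-injective v {Fin.suc i} {Fin.suc j} (inj₂ (v≡nb , _)) =
      ⊥-elim (irreflexive (subst (Adj v) (sym v≡nb) (nb-adj v j)))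

    star-centre : ∀ v i → elemDist v (star v i) ≡ 0
    star-centre v 0F = d-self v
    star-centre v (Fin.suc i) rewrite d-self v = refl

    star-cases : ∀ w v i → elemDist w (star v i) ≡ d w v ⊎ elemDist w (star v i) ≡ pred (d w v)
    star-cases w v 0F = inj₁ refl
    star-cases w v (Fin.suc i) = edgeDist-cases w (nb-adj v i)

    side : V → V → Fin 5 → Fin 2
    side w v i = bitOf (elemDist w (star v i) ≟ d w v)

    side-injective : ∀ w v i j → side w v i ≡ side w v j →
                     elemDist w (star v i) ≡ elemDist w (star v j)
    side-injective w v i j =
      bitOf-injective (star-cases w v i) (star-cases w v j) (elemDist w (star v i) ≟ d w v) _

    -- A landmark at v sees all of the star at distance 0, and two further landmarks
    -- split its five elements into at most four classes.
    ¬MixedResolving-centre+2 : ∀ v a b → ¬ MixedResolving (v ∷ a ∷ b ∷ [])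
    ¬MixedResolving-centre+2 v a b resolving
      with i , j , i<j , eq ← pigeonhole ≤-refl (λ i → combine (side a v i) (side b v i))
      with ea , eb ← combine-injective (side a v i) (side b v i) (side a v j) (side b v j) eq
      with resolving (star v i) (star v j) (λ same → <⇒≢ᶠ i<j (star-injective v same))
    ... | here r = ¬resolves (trans (star-centre v i) (sym (star-centre v j))) r
    ... | there (here r) = ¬resolves (side-injective a v i j ea) r
    ... | there (there (here r)) = ¬resolves (side-injective b v i j eb) r

    resolving⇒4≤length : V → ∀ S → MixedResolving S → 4 ≤ length S
    resolving⇒4≤length v₀ [] resolving with resolving (star v₀ 0F) (star v₀ 1F) (λ ())
    ... | ()
    resolving⇒4≤length _ (v ∷ []) resolving =
      ⊥-elim (¬MixedResolving-centre+2 v v v λ x y ne → there (there (resolving x y ne)))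
    resolving⇒4≤length _ (v ∷ a ∷ []) resolving =
      ⊥-elim (¬MixedResolving-centre+2 v v a λ x y ne → there (resolving x y ne))
    resolving⇒4≤length _ (v ∷ a ∷ b ∷ []) resolving = ⊥-elim (¬MixedResolving-centre+2 v a b resolving)
    resolving⇒4≤length _ (_ ∷ _ ∷ _ ∷ _ ∷ _) _ = s≤s (s≤s (s≤s (s≤s z≤n)))

-- Cartesian products

module CartesianProduct {A B : Set} (Adj₁ : A → A → Set) (Adj₂ : B → B → Set) where

  CartesianAdj : A × B → A × B → Set
  CartesianAdj (a , b) (a' , b') = (Adj₁ a a' × b ≡ b') ⊎ (a ≡ a' × Adj₂ b b')

  private
    module G₁ = Graph Adj₁
    module G₂ = Graph Adj₂
  open Graph CartesianAdj
  open WalkProperties CartesianAdj using (_++ʷ_)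

  liftˡ : ∀ {a a' k} (b : B) → G₁.Walk a a' k → Walk (a , b) (a' , b) k
  liftˡ b G₁.here = here
  liftˡ b (G₁.step x p) = step (inj₁ (x , refl)) (liftˡ b p)

  liftʳ : ∀ {b b' k} (a : A) → G₂.Walk b b' k → Walk (a , b) (a , b') k
  liftʳ a G₂.here = here
  liftʳ a (G₂.step y p) = step (inj₂ (refl , y)) (liftʳ a p)

  project : ∀ {a b a' b' k} → Walk (a , b) (a' , b') k →
            ∃₂ λ k₁ k₂ → G₁.Walk a a' k₁ × G₂.Walk b b' k₂ × k₁ + k₂ ≡ k
  project here = 0 , 0 , G₁.here , G₂.here , refl
  project (step (inj₁ (x , refl)) p) with k₁ , k₂ , p₁ , p₂ , eq ← project p =
    suc k₁ , k₂ , G₁.step x p₁ , p₂ , cong suc eq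
  project (step (inj₂ (refl , y)) p) with k₁ , k₂ , p₁ , p₂ , eq ← project p =
    k₁ , suc k₂ , p₁ , G₂.step y p₂ , trans (+-suc k₁ k₂) (cong suc eq)

  sumDist : (A → A → ℕ) → (B → B → ℕ) → A × B → A × B → ℕ
  sumDist d₁ d₂ (a , b) (a' , b') = d₁ a a' + d₂ b b'

  sumDist-isDistance : ∀ {d₁ d₂} → IsDistance Adj₁ d₁ → IsDistance Adj₂ d₂ →
                       IsDistance CartesianAdj (sumDist d₁ d₂)
  sumDist-isDistance isD₁ isD₂ (a , b) (a' , b') =
    liftˡ b (proj₁ (isD₁ a a')) ++ʷ liftʳ a' (proj₁ (isD₂ b b')) ,
    λ { k p → let k₁ , k₂ , p₁ , p₂ , eq = project p in
              subst (_ ≤_) eq (+-mono-≤ (proj₂ (isD₁ a a') k₁ p₁) (proj₂ (isD₂ b b') k₂ p₂)) }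

-- The cycle ℤ/N

data Arc (x y d : ℕ) : Set where
  ahead : x + d ≡ y → Arc x y d
  behind : y + d ≡ x → Arc x y d

Arc⇒∣-∣ : ∀ {x y d} → Arc x y d → ∣ x - y ∣ ≡ d
Arc⇒∣-∣ {x} {d = d} (ahead refl) = ∣m-m+n∣≡n x d
Arc⇒∣-∣ {y = y} {d} (behind refl) = trans (∣-∣-comm (y + d) y) (∣m-m+n∣≡n y d)

-- Opaque outside the next block, so that unification keeps cycDist N x y intact.
opaque
  cycDist : ℕ → ℕ → ℕ → ℕ
  cycDist N x y = ∣ x - y ∣ ⊓ (N ∸ ∣ x - y ∣)

-- CycAdj N a b unfolds to CycAdjℕ N (toℕ a) (toℕ b); on ℕ the equations can be matched on.
CycAdjℕ : ℕ → ℕ → ℕ → Set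
CycAdjℕ N y y' = suc y ≡ y' ⊎ suc y' ≡ y ⊎ (y ≡ 0 × suc y' ≡ N) ⊎ (y' ≡ 0 × suc y ≡ N)

opaque
  unfolding cycDist

  cycDist-comm : ∀ N x y → cycDist N x y ≡ cycDist N y x
  cycDist-comm N x y rewrite ∣-∣-comm x y = refl

  cycDist-self : ∀ N x → cycDist N x x ≡ 0
  cycDist-self N x rewrite ∣n-n∣≡0 x = refl

  cycDist-arcs : ∀ {N x y d d'} → Arc x y d ⊎ Arc x y d' → d + d' ≡ N → cycDist N x y ≡ d ⊓ d'
  cycDist-arcs {d = d} {d'} (inj₁ arc) refl rewrite Arc⇒∣-∣ arc = cong (d ⊓_) (m+n∸m≡n d d')
  cycDist-arcs {d = d} {d'} (inj₂ arc) refl rewrite Arc⇒∣-∣ arc =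
    trans (cong (d' ⊓_) (trans (cong (_∸ d') (+-comm d d')) (m+n∸m≡n d' d))) (⊓-comm d' d)

  private
    ∣-∣-suc₁ : ∀ x y → ∣ x - y ∣ ≤ suc ∣ x - suc y ∣
    ∣-∣-suc₁ zero y = ≤-trans (n≤1+n y) (n≤1+n (suc y))
    ∣-∣-suc₁ (suc zero) zero = s≤s z≤n
    ∣-∣-suc₁ (suc (suc x)) zero = ≤-refl
    ∣-∣-suc₁ (suc x) (suc y) = ∣-∣-suc₁ x y

    ∣-∣-suc₂ : ∀ x y → ∣ x - suc y ∣ ≤ suc ∣ x - y ∣
    ∣-∣-suc₂ zero y = ≤-refl
    ∣-∣-suc₂ (suc zero) zero = z≤n
    ∣-∣-suc₂ (suc (suc x)) zero = ≤-trans (n≤1+n (suc x)) (n≤1+n (suc (suc x)))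
    ∣-∣-suc₂ (suc x) (suc y) = ∣-∣-suc₂ x y

    ∸-lipschitz : ∀ N {D D'} → D' ≤ suc D → N ∸ D ≤ suc (N ∸ D')
    ∸-lipschitz N {D} {D'} D'≤1+D = ≤-trans (∸-monoʳ-≤ (suc N) D'≤1+D) (suc∸≤ N D')
      where
      suc∸≤ : ∀ N D → suc N ∸ D ≤ suc (N ∸ D)
      suc∸≤ N zero = ≤-refl
      suc∸≤ zero (suc D) = subst (_≤ suc (0 ∸ suc D)) (sym (0∸n≡0 D)) z≤n
      suc∸≤ (suc N) (suc D) = suc∸≤ N D

    cycDist-0 : ∀ N x → cycDist N x 0 ≡ (N ∸ x) ⊓ x
    cycDist-0 N x rewrite ∣-∣-identityʳ x = ⊓-comm x (N ∸ x)

    suc-∸ : ∀ {x y} → x ≤ y → suc y ∸ x ≡ suc (y ∸ x)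
    suc-∸ {zero} _ = refl
    suc-∸ {suc x} {suc y} (s≤s x≤y) = suc-∸ x≤y

    cycDist-wrap₁ : ∀ {N x y} → x < N → suc y ≡ N → cycDist N x 0 ≤ suc (cycDist N x y)
    cycDist-wrap₁ {N} {x} {y} x<N refl =
      subst (_≤ suc (cycDist N x y)) (sym (cycDist-0 N x)) (⊓-mono-≤ p q)
      where
      x≤y : x ≤ y
      x≤y = s≤s⁻¹ x<N
      p : suc y ∸ x ≤ suc ∣ x - y ∣
      p rewrite m≤n⇒∣m-n∣≡n∸m x≤y | suc-∸ x≤y = ≤-refl
      q : x ≤ suc (suc y ∸ ∣ x - y ∣)
      q rewrite m≤n⇒∣m-n∣≡n∸m x≤y | suc-∸ (m∸n≤m y x) | m∸[m∸n]≡n x≤y = ≤-trans (n≤1+n x) (n≤1+n (suc x))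

    cycDist-wrap₂ : ∀ {N x y} → x < N → suc y ≡ N → cycDist N x y ≤ suc (cycDist N x 0)
    cycDist-wrap₂ {N} {x} {y} x<N refl =
      subst (λ z → cycDist N x y ≤ suc z) (sym (cycDist-0 N x)) (⊓-mono-≤ p q)
      where
      x≤y : x ≤ y
      x≤y = s≤s⁻¹ x<N
      p : ∣ x - y ∣ ≤ suc (suc y ∸ x)
      p rewrite m≤n⇒∣m-n∣≡n∸m x≤y | suc-∸ x≤y = ≤-trans (n≤1+n _) (n≤1+n _)
      q : suc y ∸ ∣ x - y ∣ ≤ suc x
      q rewrite m≤n⇒∣m-n∣≡n∸m x≤y | suc-∸ (m∸n≤m y x) | m∸[m∸n]≡n x≤y = ≤-refl

  cycDist-lipschitz : ∀ {N x y y'} → x < N → CycAdjℕ N y y' → cycDist N x y ≤ suc (cycDist N x y')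
  cycDist-lipschitz {N} {x} {y} _ (inj₁ refl) = ⊓-mono-≤ (∣-∣-suc₁ x y) (∸-lipschitz N (∣-∣-suc₂ x y))
  cycDist-lipschitz {N} {x} {y' = y'} _ (inj₂ (inj₁ refl)) =
    ⊓-mono-≤ (∣-∣-suc₂ x y') (∸-lipschitz N (∣-∣-suc₁ x y'))
  cycDist-lipschitz x<N (inj₂ (inj₂ (inj₁ (refl , wrap)))) = cycDist-wrap₁ x<N wrap
  cycDist-lipschitz x<N (inj₂ (inj₂ (inj₂ (refl , wrap)))) = cycDist-wrap₂ x<N wrap


cycDist-short : ∀ {N} x y d e → Arc x y d ⊎ Arc x y (d + e) → d + (d + e) ≡ N → cycDist N x y ≡ d
cycDist-short {N} x y d e arc sum = trans (cycDist-arcs {N} {x} {y} arc sum) (m≤n⇒m⊓n≡m (m≤m+n d e))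

cycDist-≥ : ∀ {N} x y d f g → Arc x y (d + f) ⊎ Arc x y (d + g) → d + f + (d + g) ≡ N → d ≤ cycDist N x y
cycDist-≥ {N} x y d f g arc sum =
  subst (d ≤_) (sym (cycDist-arcs {N} {x} {y} arc sum)) (⊓-glb (m≤m+n d f) (m≤m+n d g))

CycAdj-sym : ∀ {N} {a b : Fin N} → CycAdj N a b → CycAdj N b a
CycAdj-sym (inj₁ e) = inj₂ (inj₁ e)
CycAdj-sym (inj₂ (inj₁ e)) = inj₁ e
CycAdj-sym (inj₂ (inj₂ (inj₁ e))) = inj₂ (inj₂ (inj₂ e))
CycAdj-sym (inj₂ (inj₂ (inj₂ e))) = inj₂ (inj₂ (inj₁ e))

module CycleWalks (P : ℕ) where
  private N = suc P
  open Graph (CycAdj N)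
  open WalkProperties (CycAdj N)

  walkUp : ∀ (a b : Fin N) d → toℕ a + d ≡ toℕ b → Walk a b d
  walkUp a b zero a+0≡b = subst (λ c → Walk a c 0) (toℕ-injective (trans (sym (+-identityʳ _)) a+0≡b)) here
  walkUp a b (suc d) a+1+d≡b = step (inj₁ (sym (toℕ-fromℕ< a+1<N))) (walkUp a⁺ b d a⁺+d≡b)
    where
    a+1<N : suc (toℕ a) < N
    a+1<N = ≤-trans (s≤s (≤-trans (m≤m+n (suc (toℕ a)) d) (≤-reflexive (trans (sym (+-suc (toℕ a) d)) a+1+d≡b))))
                    (toℕ<n b)
    a⁺ = fromℕ< a+1<N
    a⁺+d≡b : toℕ a⁺ + d ≡ toℕ b
    a⁺+d≡b = trans (cong (_+ d) (toℕ-fromℕ< a+1<N)) (trans (sym (+-suc (toℕ a) d)) a+1+d≡b)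

  walkAround : ∀ (a b : Fin N) → toℕ a ≤ toℕ b → Walk b a (N ∸ (toℕ b ∸ toℕ a))
  walkAround a b a≤b = castʷ steps (toLast ++ʷ step wrap (walkUp Fin.zero a (toℕ a) refl))
    where
    last = fromℕ< (n<1+n P)
    b≤P : toℕ b ≤ P
    b≤P = s≤s⁻¹ (toℕ<n b)
    toLast : Walk b last (P ∸ toℕ b)
    toLast = walkUp b last (P ∸ toℕ b) (trans (m+[n∸m]≡n b≤P) (sym (toℕ-fromℕ< (n<1+n P))))
    wrap : CycAdj N last Fin.zero
    wrap = inj₂ (inj₂ (inj₂ (refl , cong suc (toℕ-fromℕ< (n<1+n P)))))
    steps : P ∸ toℕ b + suc (toℕ a) ≡ N ∸ (toℕ b ∸ toℕ a)
    steps = begin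
      P ∸ toℕ b + suc (toℕ a)         ≡⟨ +-∸-comm (suc (toℕ a)) b≤P ⟨
      P + suc (toℕ a) ∸ toℕ b         ≡⟨ cong (_∸ toℕ b) (+-suc P (toℕ a)) ⟩
      N + toℕ a ∸ toℕ b                       ≡⟨ cong (N + toℕ a ∸_) (m+[n∸m]≡n a≤b) ⟨
      N + toℕ a ∸ (toℕ a + (toℕ b ∸ toℕ a))   ≡⟨ ∸-+-assoc (N + toℕ a) (toℕ a) _ ⟨
      N + toℕ a ∸ toℕ a ∸ (toℕ b ∸ toℕ a)     ≡⟨ cong (_∸ (toℕ b ∸ toℕ a)) (m+n∸n≡m N (toℕ a)) ⟩
      N ∸ (toℕ b ∸ toℕ a)                     ∎
      where open ≡-Reasoning

  cycleWalk≤ : ∀ (a b : Fin N) → toℕ a ≤ toℕ b → Walk a b (cycDist N (toℕ a) (toℕ b))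
  cycleWalk≤ a b a≤b = castʷ (sym (cycDist-arcs (inj₁ (ahead (m+[n∸m]≡n a≤b))) (m+[n∸m]≡n D≤N)))
    (shorter (walkUp a b _ (m+[n∸m]≡n a≤b)) (reverse CycAdj-sym (walkAround a b a≤b)))
    where
    D≤N : toℕ b ∸ toℕ a ≤ N
    D≤N = ≤-trans (m∸n≤m (toℕ b) (toℕ a)) (<⇒≤ (toℕ<n b))

  cycleWalk : ∀ (a b : Fin N) → Walk a b (cycDist N (toℕ a) (toℕ b))
  cycleWalk a b with ≤-total (toℕ a) (toℕ b)
  ... | inj₁ a≤b = cycleWalk≤ a b a≤b
  ... | inj₂ b≤a = castʷ (cycDist-comm N (toℕ b) (toℕ a)) (reverse CycAdj-sym (cycleWalk≤ b a b≤a))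

cycDist-isDistance : ∀ N → IsDistance (CycAdj N) (λ a b → cycDist N (toℕ a) (toℕ b))
cycDist-isDistance (suc P) a b =
  cycleWalk a b , λ k p → subst (_≤ k) (cycDist-comm (suc P) (toℕ b) (toℕ a)) (bound p)
  where
  open CycleWalks P
  open WalkProperties (CycAdj (suc P))
  bound : ∀ {a k} → Graph.Walk (CycAdj (suc P)) a b k → cycDist (suc P) (toℕ b) (toℕ a) ≤ k
  bound {a} {k} p = subst (_ ≤_) (cong (_+ k) (cycDist-self (suc P) (toℕ b)))
    (potential≤length (λ z → cycDist (suc P) (toℕ b) (toℕ z)) (cycDist-lipschitz (toℕ<n b)) p)

-- The torus and the lower bound

torusDist : (m n : ℕ) → Fin m × Fin n → Fin m × Fin n → ℕ
torusDist m n = CartesianProduct.sumDist (CycAdj m) (CycAdj n)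
  (λ a b → cycDist m (toℕ a) (toℕ b)) (λ a b → cycDist n (toℕ a) (toℕ b))

torusDist-isDistance : ∀ m n → IsDistance (TorusAdj m n) (torusDist m n)
torusDist-isDistance m n =
  CartesianProduct.sumDist-isDistance (CycAdj m) (CycAdj n) (cycDist-isDistance m) (cycDist-isDistance n)

TorusAdj-sym : ∀ {m n} {u v : Fin m × Fin n} → TorusAdj m n u v → TorusAdj m n v u
TorusAdj-sym (inj₁ (a , e)) = inj₁ (CycAdj-sym a , sym e)
TorusAdj-sym (inj₂ (e , a)) = inj₂ (sym e , CycAdj-sym a)

CycAdj-irreflexive : ∀ {N} {a : Fin N} → 2 ≤ N → ¬ CycAdj N a a
CycAdj-irreflexive _ (inj₁ a+1≡a) = 1+n≢n a+1≡a
CycAdj-irreflexive _ (inj₂ (inj₁ a+1≡a)) = 1+n≢n a+1≡a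
CycAdj-irreflexive 2≤N (inj₂ (inj₂ (inj₁ (a≡0 , a+1≡N)))) =
  <-irrefl refl (subst (2 ≤_) (trans (sym a+1≡N) (cong suc a≡0)) 2≤N)
CycAdj-irreflexive 2≤N (inj₂ (inj₂ (inj₂ (a≡0 , a+1≡N)))) =
  <-irrefl refl (subst (2 ≤_) (trans (sym a+1≡N) (cong suc a≡0)) 2≤N)

TorusAdj-irreflexive : ∀ {m n} {v : Fin m × Fin n} → 2 ≤ m → 2 ≤ n → ¬ TorusAdj m n v v
TorusAdj-irreflexive 2≤m _ (inj₁ (a , _)) = CycAdj-irreflexive 2≤m a
TorusAdj-irreflexive _ 2≤n (inj₂ (_ , a)) = CycAdj-irreflexive 2≤n a

Succ : ℕ → ℕ → ℕ → Set
Succ N x y = suc x ≡ y ⊎ (y ≡ 0 × suc x ≡ N)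

Succ⇒CycAdj : ∀ {N} {a b : Fin N} → Succ N (toℕ a) (toℕ b) → CycAdj N a b
Succ⇒CycAdj (inj₁ e) = inj₁ e
Succ⇒CycAdj (inj₂ e) = inj₂ (inj₂ (inj₂ e))

Succ-asym : ∀ {P x y} → Succ (3 + P) x y → ¬ Succ (3 + P) y x
Succ-asym {x = x} (inj₁ refl) (inj₁ x+2≡x) = m≢1+n+m x {1} (sym x+2≡x)
Succ-asym (inj₁ refl) (inj₂ (refl , ()))
Succ-asym (inj₂ (refl , ())) (inj₁ refl)
Succ-asym (inj₂ (refl , _)) (inj₂ (refl , ()))

module CycleNeighbours (P : ℕ) where
  private N = 3 + P

  next : Fin N → Fin N
  next i with suc (toℕ i) <? N
  ... | yes i+1<N = fromℕ< i+1<N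
  ... | no _ = Fin.zero

  prev : Fin N → Fin N
  prev Fin.zero = fromℕ (2 + P)
  prev (Fin.suc i) = inject₁ i

  next-Succ : ∀ i → Succ N (toℕ i) (toℕ (next i))
  next-Succ i with suc (toℕ i) <? N
  ... | yes i+1<N = inj₁ (sym (toℕ-fromℕ< i+1<N))
  ... | no i+1≮N = inj₂ (refl , ≤-antisym (toℕ<n i) (≮⇒≥ i+1≮N))

  prev-Succ : ∀ i → Succ N (toℕ (prev i)) (toℕ i)
  prev-Succ Fin.zero = inj₂ (refl , cong suc (toℕ-fromℕ (2 + P)))
  prev-Succ (Fin.suc i) = inj₁ (cong suc (toℕ-inject₁ i))

  next≢prev : ∀ i → next i ≢ prev i
  next≢prev i eq = Succ-asym (next-Succ i) (subst (λ c → Succ N (toℕ c) (toℕ i)) (sym eq) (prev-Succ i))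

module TorusNeighbours (P Q : ℕ) where
  private
    M = 3 + P
    N = 3 + Q
    module X = CycleNeighbours P
    module Y = CycleNeighbours Q

  neighbour : Fin M × Fin N → Fin 4 → Fin M × Fin N
  neighbour (i , j) 0F = X.next i , j
  neighbour (i , j) 1F = X.prev i , j
  neighbour (i , j) 2F = i , Y.next j
  neighbour (i , j) 3F = i , Y.prev j

  neighbour-adj : ∀ v d → TorusAdj M N v (neighbour v d)
  neighbour-adj (i , j) 0F = inj₁ (Succ⇒CycAdj (X.next-Succ i) , refl)
  neighbour-adj (i , j) 1F = inj₁ (CycAdj-sym (Succ⇒CycAdj (X.prev-Succ i)) , refl)
  neighbour-adj (i , j) 2F = inj₂ (refl , Succ⇒CycAdj (Y.next-Succ j))
  neighbour-adj (i , j) 3F = inj₂ (refl , CycAdj-sym (Succ⇒CycAdj (Y.prev-Succ j)))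

  private
    moves : ∀ v d → neighbour v d ≢ v
    moves v d eq = TorusAdj-irreflexive (s≤s (s≤s z≤n)) (s≤s (s≤s z≤n))
                     (subst (TorusAdj M N v) eq (neighbour-adj v d))

  neighbour-injective : ∀ v {d e} → neighbour v d ≡ neighbour v e → d ≡ e
  neighbour-injective v {0F} {0F} _ = refl
  neighbour-injective v {1F} {1F} _ = refl
  neighbour-injective v {2F} {2F} _ = refl
  neighbour-injective v {3F} {3F} _ = refl
  neighbour-injective (i , j) {0F} {1F} eq = ⊥-elim (X.next≢prev i (,-injectiveˡ eq))
  neighbour-injective (i , j) {1F} {0F} eq = ⊥-elim (X.next≢prev i (sym (,-injectiveˡ eq)))
  neighbour-injective (i , j) {2F} {3F} eq = ⊥-elim (Y.next≢prev j (,-injectiveʳ eq))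
  neighbour-injective (i , j) {3F} {2F} eq = ⊥-elim (Y.next≢prev j (sym (,-injectiveʳ eq)))
  neighbour-injective v {0F} {2F} eq = ⊥-elim (moves v 0F (cong₂ _,_ (,-injectiveˡ eq) refl))
  neighbour-injective v {0F} {3F} eq = ⊥-elim (moves v 0F (cong₂ _,_ (,-injectiveˡ eq) refl))
  neighbour-injective v {1F} {2F} eq = ⊥-elim (moves v 1F (cong₂ _,_ (,-injectiveˡ eq) refl))
  neighbour-injective v {1F} {3F} eq = ⊥-elim (moves v 1F (cong₂ _,_ (,-injectiveˡ eq) refl))
  neighbour-injective v {2F} {0F} eq = ⊥-elim (moves v 0F (cong₂ _,_ (sym (,-injectiveˡ eq)) refl))
  neighbour-injective v {3F} {0F} eq = ⊥-elim (moves v 0F (cong₂ _,_ (sym (,-injectiveˡ eq)) refl))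
  neighbour-injective v {2F} {1F} eq = ⊥-elim (moves v 1F (cong₂ _,_ (sym (,-injectiveˡ eq)) refl))
  neighbour-injective v {3F} {1F} eq = ⊥-elim (moves v 1F (cong₂ _,_ (sym (,-injectiveˡ eq)) refl))

  torus-resolving⇒4≤length : ∀ S → Graph.MixedResolving (TorusAdj M N) S → 4 ≤ length S
  torus-resolving⇒4≤length =
    ElementDistance.FourNeighbours.resolving⇒4≤length TorusAdj-sym (torusDist M N) (torusDist-isDistance M N)
      (TorusAdj-irreflexive (s≤s (s≤s z≤n)) (s≤s (s≤s z≤n))) neighbour neighbour-adj neighbour-injective
      (Fin.zero , Fin.zero)

-- One cycle coordinate: shapes of its elements and their fibres

data Kind : Set where
  point edge : Kind

width : Kind → ℕ
width point = 0
width edge = 1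

record Profile : Set where
  constructor profile
  field
    kind : Kind
    d₀ d₁ : ℕ

open Profile public

-- How two elements of a cycle with the same difference of distances to the landmarks 0 and t
-- can still differ, as seen through their kinds and distances d₀, d₁ to the landmarks 0 and 1.
data Outcome (Same : Set) (p p' : Profile) : Set where
  same : Same → p ≡ p' → Outcome Same p p'
  apart : d₀ p ≡ d₀ p' → d₁ p ≢ d₁ p' → Outcome Same p p'
  point-edge : kind p ≡ point → kind p' ≡ edge → d₀ p ≡ suc (d₀ p') → d₁ p' ≡ suc (d₁ p) → Outcome Same p p'
  edge-point : kind p ≡ edge → kind p' ≡ point → d₀ p' ≡ suc (d₀ p) → d₁ p ≡ suc (d₁ p') → Outcome Same p p'

Outcome-sym : ∀ {S S' p p'} → (S → S') → Outcome S p p' → Outcome S' p' p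
Outcome-sym f (same s eq) = same (f s) (sym eq)
Outcome-sym f (apart e₀ ne₁) = apart (sym e₀) (λ e₁ → ne₁ (sym e₁))
Outcome-sym f (point-edge κ κ' e₀ e₁) = edge-point κ' κ e₀ e₁
Outcome-sym f (edge-point κ κ' e₀ e₁) = point-edge κ' κ e₀ e₁

double-injective : ∀ {m n} → m + m ≡ n + n → m ≡ n
double-injective {zero} {zero} _ = refl
double-injective {suc m} {suc n} eq =
  cong suc (double-injective (suc-injective (trans (sym (+-suc m m)) (trans (suc-injective eq) (+-suc n n)))))

double≢suc-double : ∀ m n → m + m ≢ suc (n + n)
double≢suc-double zero n ()
double≢suc-double (suc m) zero eq = 0≢1+n (trans (sym (suc-injective eq)) (+-suc m m))
double≢suc-double (suc m) (suc n) eq = double≢suc-double m n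
  (suc-injective (trans (sym (+-suc m m)) (trans (suc-injective eq) (cong suc (+-suc n n)))))

pred≢suc : ∀ j → pred j ≢ suc j
pred≢suc zero ()
pred≢suc (suc j) = m≢1+n+m j {1}

parity : ∀ {κ κ' j j'} → j + j + width κ ≡ j' + j' + width κ' → κ ≡ κ' × j ≡ j'
parity {point} {point} {j} {j'} eq =
  refl , double-injective (trans (sym (+-identityʳ (j + j))) (trans eq (+-identityʳ (j' + j'))))
parity {point} {edge} {j} {j'} eq =
  ⊥-elim (double≢suc-double j j' (trans (sym (+-identityʳ (j + j))) (trans eq (+-comm (j' + j') 1))))
parity {edge} {point} {j} {j'} eq =
  ⊥-elim (double≢suc-double j' j (trans (sym (+-identityʳ (j' + j'))) (trans (sym eq) (+-comm (j + j) 1))))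
parity {edge} {edge} eq = refl , double-injective (+-cancelʳ-≡ 1 _ _ eq)

-- The near side has length k + r and the far side length k, which shifts parities by r.
nearFar-outcome : ∀ {S r κ κ' j j'} → r ≡ 0 ⊎ r ≡ 1 → j + j + width κ ≡ j' + j' + width κ' + r →
           Outcome S (profile κ j (pred j)) (profile κ' j' (suc j'))
nearFar-outcome {κ = κ} {κ'} {j} {j'} (inj₁ refl) eq
  with refl , refl ← parity {κ} {κ'} {j} {j'} (trans eq (+-identityʳ _)) = apart refl (pred≢suc j)
nearFar-outcome {κ = point} {point} {j} {j'} (inj₂ refl) eq =
  ⊥-elim (double≢suc-double j j' (trans (sym (+-identityʳ (j + j))) (trans eq (solve (j' ∷ [])))))
nearFar-outcome {κ = point} {edge} {j} {j'} (inj₂ refl) eq with refl ← double-injective {j} {suc j'}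
  (trans (sym (+-identityʳ (j + j))) (trans eq (solve (j' ∷ []))))     = point-edge refl refl refl refl
nearFar-outcome {κ = edge} {point} {j} {j'} (inj₂ refl) eq with refl ← double-injective {j} {j'}
  (+-cancelʳ-≡ 1 _ _ (trans eq (cong (_+ 1) (+-identityʳ (j' + j'))))) = apart refl (pred≢suc j)
nearFar-outcome {κ = edge} {edge} {j} {j'} (inj₂ refl) eq =
  ⊥-elim (double≢suc-double j j' (+-cancelʳ-≡ 1 _ _ (trans eq (solve (j' ∷ [])))))

excess≡1 : ∀ κ b → width κ + (b + b) ≡ 1 → κ ≡ edge × b ≡ 0
excess≡1 point b eq = ⊥-elim (double≢suc-double b 0 eq)
excess≡1 edge zero _ = refl , refl
excess≡1 edge (suc b) eq = ⊥-elim (0≢1+n (sym (trans (cong suc (sym (+-suc b b))) (suc-injective eq))))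

n≢pred : ∀ {n} → 1 ≤ n → n ≢ pred n
n≢pred {suc n} _ = 1+n≢n

excess≡0 : ∀ κ b → width κ + (b + b) ≡ 0 → κ ≡ point × b ≡ 0
excess≡0 point zero _ = refl , refl

data Side : Set where
  near far : Side

-- An element of ℤ/N, N = 2k + r, at distance j from 0 and b from t = k + r, on the side of the
-- diameter through 0 and t that contains 1 (near) or not (far).  The antipode of 0, the point t
-- when r = 1 or the edge {t, t + 1} when r = 0, has no such description.
data Shape : Set where
  onSide : Side → Kind → (j b : ℕ) → Shape
  antipode : Kind → Shape

shapeKind : Shape → Kind
shapeKind (onSide _ κ _ _) = κ
shapeKind (antipode κ) = κ

fibre-identity : ∀ {w w' j j' b b' L L'} → j + b' ≡ j' + b → w + (j + b) ≡ L → w' + (j' + b') ≡ L' →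
                 j + j + w + L' ≡ j' + j' + w' + L
fibre-identity {w} {w'} {j} {j'} {b} {b'} fib refl refl = begin
  j + j + w + (w' + (j' + b'))   ≡⟨ solve (w ∷ w' ∷ j ∷ j' ∷ b' ∷ []) ⟩
  (j + b') + (j + w + w' + j')   ≡⟨ cong (_+ (j + w + w' + j')) fib ⟩
  (j' + b) + (j + w + w' + j')   ≡⟨ solve (w ∷ w' ∷ j ∷ j' ∷ b ∷ []) ⟩
  j' + j' + w' + (w + (j + b))   ∎
  where open ≡-Reasoning

excess : ∀ w c b {e} → w + (c + b + b) ≡ c + e → w + (b + b) ≡ e
excess w c b {e} eq = +-cancelˡ-≡ c (w + (b + b)) e (begin
  c + (w + (b + b))   ≡⟨ solve (w ∷ c ∷ b ∷ []) ⟩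
  w + (c + b + b)     ≡⟨ eq ⟩
  c + e               ∎)
  where open ≡-Reasoning

shift : ∀ {a a' k r} → a + k ≡ a' + (k + r) → a ≡ a' + r
shift {a} {a'} {k} {r} eq = +-cancelʳ-≡ k a (a' + r) (trans eq (solve (a' ∷ k ∷ r ∷ [])))

module CycleShapes (k r : ℕ) where

  t : ℕ
  t = k + r

  halfLength : Side → ℕ
  halfLength near = t
  halfLength far = k

  -- the distances from 0, 1 and t
  h₀ h₁ hₜ : Shape → ℕ
  h₀ (onSide _ _ j _) = j
  h₀ (antipode point) = k
  h₀ (antipode edge) = pred k
  h₁ (onSide near _ j _) = pred j
  h₁ (onSide far _ j _) = suc j
  h₁ s@(antipode _) = h₀ s
  hₜ (onSide _ _ _ b) = b
  hₜ (antipode _) = 0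

  -- make the shape of an element unique; for instance 0 is only `onSide far point 0 k`
  Bounds : Side → Kind → ℕ → ℕ → Set
  Bounds near point j b = 1 ≤ j × r ≤ b
  Bounds near edge _ _ = ⊤
  Bounds far point _ b = 1 ≤ b
  Bounds far edge _ b = 1 ≤ r + b

  Valid : Shape → Set
  Valid (onSide σ κ j b) = width κ + (j + b) ≡ halfLength σ × Bounds σ κ j b
  Valid (antipode point) = r ≡ 1
  Valid (antipode edge) = r ≡ 0

  shapeProfile : Shape → Profile
  shapeProfile s = profile (shapeKind s) (h₀ s) (h₁ s)

  SameFibre : Shape → Shape → Set
  SameFibre s s' = h₀ s + hₜ s' ≡ h₀ s' + hₜ s

  FibreOutcome : Shape → Shape → Set
  FibreOutcome s s' = Outcome (s ≡ s') (shapeProfile s) (shapeProfile s')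

  module _ (r≡0⊎1 : r ≡ 0 ⊎ r ≡ 1) (1≤k : 1 ≤ k) (r≡0⇒2≤k : r ≡ 0 → 2 ≤ k) where

    sameSide-fibre : ∀ {σ κ κ' j j' b b'} → j + b' ≡ j' + b →
                     j + j + width κ + halfLength σ ≡ j' + j' + width κ' + halfLength σ →
                     FibreOutcome (onSide σ κ j b) (onSide σ κ' j' b')
    sameSide-fibre {σ} {κ} {κ'} {j} {j'} fib eq
      with refl , refl ← parity {κ} {κ'} {j} {j'} (+-cancelʳ-≡ _ _ _ eq)
      with refl ← +-cancelˡ-≡ j _ _ fib = same refl refl

    onSide-fibre : ∀ {σ σ' κ κ' j j' b b'} → Valid (onSide σ κ j b) → Valid (onSide σ' κ' j' b') →
                   j + b' ≡ j' + b → FibreOutcome (onSide σ κ j b) (onSide σ' κ' j' b')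
    onSide-fibre {σ} {σ'} {κ} {κ'} {j} {j'} {b} {b'} (v , _) (v' , _) fib = by-sides σ σ' identity
      where
      identity = fibre-identity {width κ} {width κ'} {j} {j'} {b} {b'} fib v v'
      by-sides : ∀ σ σ' → j + j + width κ + halfLength σ' ≡ j' + j' + width κ' + halfLength σ →
                 FibreOutcome (onSide σ κ j b) (onSide σ' κ' j' b')
      by-sides near near eq = sameSide-fibre fib eq
      by-sides far far eq = sameSide-fibre fib eq
      by-sides near far eq = nearFar-outcome r≡0⊎1 (shift {j + j + width κ} {j' + j' + width κ'} {k} {r} eq)
      by-sides far near eq =
        Outcome-sym sym (nearFar-outcome r≡0⊎1 (shift {j' + j' + width κ'} {j + j + width κ} {k} {r} (sym eq)))

    halfLength-even : r ≡ 0 → ∀ σ → halfLength σ ≡ pred k + 1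
    halfLength-even r≡0 near = trans (cong (k +_) r≡0) (trans (+-identityʳ k) (halfLength-even r≡0 far))
    halfLength-even r≡0 far = trans (sym (suc-pred k {{>-nonZero 1≤k}})) (+-comm 1 (pred k))

    antipode-fibre : ∀ {κ σ κ' j b} → Valid (antipode κ) → Valid (onSide σ κ' j b) →
                     SameFibre (antipode κ) (onSide σ κ' j b) → FibreOutcome (antipode κ) (onSide σ κ' j b)
    antipode-fibre {point} {near} {κ'} {j} {b} r≡1 (v , _) fib
      with refl ← trans (sym (+-identityʳ j)) (sym fib)
      with refl , refl ← excess≡1 κ' b (excess (width κ') k b (trans v (cong (k +_) r≡1)))
      = apart (sym (+-identityʳ k)) λ k≡k-1 → n≢pred 1≤k (trans k≡k-1 (cong pred (+-identityʳ k)))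
    antipode-fibre {point} {far} {κ'} {j} {b} r≡1 (v , bounds) fib
      with refl ← trans (sym (+-identityʳ j)) (sym fib)
      with refl , refl ← excess≡0 κ' b (excess (width κ') k b (trans v (sym (+-identityʳ k))))
      with () ← bounds
    antipode-fibre {edge} {σ} {κ'} {j} {b} r≡0 (v , bounds) fib
      with refl ← trans (sym (+-identityʳ j)) (sym fib)
      with refl , refl ← excess≡1 κ' b (excess (width κ') (pred k) b (trans v (halfLength-even r≡0 σ)))
      = by-side σ bounds
      where
      by-side : ∀ σ → Bounds σ edge (pred k + 0) 0 →
                FibreOutcome (antipode edge) (onSide σ edge (pred k + 0) 0)
      by-side near _ = apart (sym (+-identityʳ (pred k)))
        λ e → n≢pred (suc[m]≤n⇒m≤pred[n] (r≡0⇒2≤k r≡0)) (trans e (cong pred (+-identityʳ (pred k))))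
      by-side far 1≤r+0 = ⊥-elim (<-irrefl refl (subst (λ x → 1 ≤ x + 0) r≡0 1≤r+0))

    fibre-outcome : ∀ s s' → Valid s → Valid s' → SameFibre s s' → FibreOutcome s s'
    fibre-outcome (onSide _ _ _ _) (onSide _ _ _ _) v v' fib = onSide-fibre v v' fib
    fibre-outcome (antipode _) (onSide _ _ _ _) v v' fib = antipode-fibre v v' fib
    fibre-outcome (onSide _ _ _ _) (antipode _) v v' fib = Outcome-sym sym (antipode-fibre v' v (sym fib))
    fibre-outcome (antipode point) (antipode point) _ _ _ = same refl refl
    fibre-outcome (antipode edge) (antipode edge) _ _ _ = same refl refl
    fibre-outcome (antipode point) (antipode edge) r≡1 r≡0 _ = ⊥-elim (0≢1+n (trans (sym r≡0) r≡1))
    fibre-outcome (antipode edge) (antipode point) r≡0 r≡1 _ = ⊥-elim (0≢1+n (trans (sym r≡0) r≡1))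

-- A point of ℤ/N, or the edge from p to its successor q.
data Descriptor : Set where
  pt : ℕ → Descriptor
  ed : ℕ → ℕ → Descriptor

descriptorKind : Descriptor → Kind
descriptorKind (pt _) = point
descriptorKind (ed _ _) = edge

dist₁ : ℕ → ℕ → Descriptor → ℕ
dist₁ N a (pt x) = cycDist N a x
dist₁ N a (ed p q) = cycDist N a p ⊓ cycDist N a q

Dists : ℕ → ℕ → Descriptor → ℕ → ℕ → ℕ → Set
Dists N t D a₀ a₁ aₜ = dist₁ N 0 D ≡ a₀ × dist₁ N 1 D ≡ a₁ × dist₁ N t D ≡ aₜ

⊓-exactˡ : ∀ {x y d} → x ≡ d → d ≤ y → x ⊓ y ≡ d
⊓-exactˡ refl d≤y = m≤n⇒m⊓n≡m d≤y

⊓-exactʳ : ∀ {x y d} → d ≤ x → y ≡ d → x ⊓ y ≡ d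
⊓-exactʳ d≤x refl = m≥n⇒m⊓n≡n d≤x

-- After splitting on r and substituting k, every arc length is a polynomial in the remaining
-- variables and each side condition is closed by the ring solver.
origin-dists : ∀ {k r} → 1 ≤ k → Dists (k + k + r) (k + r) (pt 0) 0 1 k
origin-dists {suc k} {r} _ =
  cycDist-self _ 0 ,
  cycDist-short 1 0 1 (k + k + r) (inj₁ (behind refl)) (solve (k ∷ r ∷ [])) ,
  cycDist-short (suc k + r) 0 (suc k) r (inj₂ (behind refl)) (sym (+-assoc (suc k) (suc k) r))

antipodePoint-dists : ∀ {k} → Dists (k + k + 1) (k + 1) (pt (k + 1)) k k 0
antipodePoint-dists {k} =
  cycDist-short 0 (k + 1) k 1 (inj₂ (ahead refl)) (sym (+-assoc k k 1)) ,
  cycDist-short 1 (k + 1) k 1 (inj₁ (ahead (+-comm 1 k))) (sym (+-assoc k k 1)) ,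
  cycDist-self _ (k + 1)

nearPoint-dists : ∀ {k r j b} → r ≤ 1 → 1 ≤ j → r ≤ b → j + b ≡ k + r →
                  Dists (k + k + r) (k + r) (pt j) j (pred j) b
nearPoint-dists {k} {j = suc j} {b} z≤n _ _ eq with refl ← trans eq (+-identityʳ k) =
  cycDist-short 0 (suc j) (suc j) (b + b) (inj₁ (ahead refl)) (solve (j ∷ b ∷ [])) ,
  cycDist-short 1 (suc j) j (suc (suc (b + b))) (inj₁ (ahead refl)) (solve (j ∷ b ∷ [])) ,
  cycDist-short (suc j + b + 0) (suc j) b (suc j + suc j)
    (inj₁ (behind (sym (+-identityʳ _)))) (solve (j ∷ b ∷ []))
nearPoint-dists {k} {j = suc j} {suc b} (s≤s z≤n) _ _ eq
  with refl ← suc-injective (trans (sym (+-suc (suc j) b)) (trans eq (+-comm k 1))) =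
  cycDist-short 0 (suc j) (suc j) (b + b + 1) (inj₁ (ahead refl)) (solve (j ∷ b ∷ [])) ,
  cycDist-short 1 (suc j) j (suc (suc (b + b + 1))) (inj₁ (ahead refl)) (solve (j ∷ b ∷ [])) ,
  cycDist-short (suc j + b + 1) (suc j) (suc b) (j + suc j)
    (inj₁ (behind (solve (j ∷ b ∷ [])))) (solve (j ∷ b ∷ []))

farPoint-dists : ∀ {k r j b} → suc j + b ≡ k → 1 ≤ b →
                 Dists (k + k + r) (k + r) (pt (k + r + b)) (suc j) (suc (suc j)) b
farPoint-dists {r = r} {j} {suc b} refl _ =
  cycDist-short 0 (suc j + suc b + r + suc b) (suc j) (suc b + r + suc b)
    (inj₂ (ahead (solve (j ∷ b ∷ r ∷ [])))) (solve (j ∷ b ∷ r ∷ [])) ,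
  cycDist-short 1 (suc j + suc b + r + suc b) (suc (suc j)) (b + r + b)
    (inj₂ (ahead (solve (j ∷ b ∷ r ∷ [])))) (solve (j ∷ b ∷ r ∷ [])) ,
  cycDist-short (suc j + suc b + r) (suc j + suc b + r + suc b) (suc b) (suc j + suc j + r)
    (inj₁ (ahead refl)) (solve (j ∷ b ∷ r ∷ []))

antipodeEdge-dists : ∀ {k} → 2 ≤ k →
                     Dists (k + k + 0) (k + 0) (ed (k + 0) (suc (k + 0))) (pred k) (pred k) 0
antipodeEdge-dists {suc (suc k)} (s≤s (s≤s z≤n)) =
  ⊓-exactʳ (cycDist-≥ 0 (suc (suc k) + 0) (suc k) 1 1 (inj₁ (ahead (solve (k ∷ [])))) (solve (k ∷ [])))
           (cycDist-short 0 (suc (suc (suc k) + 0)) (suc k) 2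
             (inj₂ (ahead (solve (k ∷ [])))) (solve (k ∷ []))) ,
  ⊓-exactˡ (cycDist-short 1 (suc (suc k) + 0) (suc k) 2 (inj₁ (ahead (solve (k ∷ [])))) (solve (k ∷ [])))
           (cycDist-≥ 1 (suc (suc (suc k) + 0)) (suc k) 1 1 (inj₁ (ahead (solve (k ∷ [])))) (solve (k ∷ []))) ,
  ⊓-exactˡ (cycDist-self (suc (suc k) + suc (suc k) + 0) (suc (suc k) + 0)) z≤n

nearEdge-dists : ∀ {k r j b} → r ≤ 1 → suc (j + b) ≡ k + r →
                 Dists (k + k + r) (k + r) (ed j (suc j)) j (pred j) b
nearEdge-dists {k} {j = j} {b} z≤n eq with refl ← trans eq (+-identityʳ k) =
  ⊓-exactˡ (cycDist-short 0 j j (suc (suc (b + b))) (inj₁ (ahead refl)) (solve (j ∷ b ∷ [])))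
           (cycDist-≥ 0 (suc j) j 1 (suc (b + b)) (inj₁ (ahead (solve (j ∷ [])))) (solve (j ∷ b ∷ []))) ,
  from-1 j ,
  ⊓-exactʳ (cycDist-≥ (suc (j + b) + 0) j b 1 (suc (j + j))
             (inj₁ (behind (solve (j ∷ b ∷ [])))) (solve (j ∷ b ∷ [])))
           (cycDist-short (suc (j + b) + 0) (suc j) b (suc (suc (j + j)))
             (inj₁ (behind (solve (j ∷ b ∷ [])))) (solve (j ∷ b ∷ [])))
  where
  from-1 : ∀ j → dist₁ (suc (j + b) + suc (j + b) + 0) 1 (ed j (suc j)) ≡ pred j
  from-1 zero = ⊓-exactʳ z≤n (cycDist-self _ 1)
  from-1 (suc j) =
    ⊓-exactˡ (cycDist-short 1 (suc j) j (suc (suc (suc (suc (b + b))))) (inj₁ (ahead refl)) (solve (j ∷ b ∷ [])))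
             (cycDist-≥ 1 (suc (suc j)) j 1 (suc (suc (suc (b + b))))
               (inj₁ (ahead (solve (j ∷ [])))) (solve (j ∷ b ∷ [])))
nearEdge-dists {k} {j = j} {b} (s≤s z≤n) eq with refl ← suc-injective (trans eq (+-comm k 1)) =
  ⊓-exactˡ (cycDist-short 0 j j (suc (b + b)) (inj₁ (ahead refl)) (solve (j ∷ b ∷ [])))
           (cycDist-≥ 0 (suc j) j 1 (b + b) (inj₁ (ahead (solve (j ∷ [])))) (solve (j ∷ b ∷ []))) ,
  from-1 j ,
  ⊓-exactʳ (cycDist-≥ (j + b + 1) j b 1 (j + j) (inj₁ (behind (solve (j ∷ b ∷ [])))) (solve (j ∷ b ∷ [])))
           (cycDist-short (j + b + 1) (suc j) b (suc (j + j))
             (inj₁ (behind (solve (j ∷ b ∷ [])))) (solve (j ∷ b ∷ [])))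
  where
  from-1 : ∀ j → dist₁ (j + b + (j + b) + 1) 1 (ed j (suc j)) ≡ pred j
  from-1 zero = ⊓-exactʳ z≤n (cycDist-self _ 1)
  from-1 (suc j) =
    ⊓-exactˡ (cycDist-short 1 (suc j) j (suc (suc (suc (b + b)))) (inj₁ (ahead refl)) (solve (j ∷ b ∷ [])))
             (cycDist-≥ 1 (suc (suc j)) j 1 (suc (suc (b + b)))
               (inj₁ (ahead (solve (j ∷ [])))) (solve (j ∷ b ∷ [])))

farEdge-wrap-dists : ∀ {k r b} → r ≤ 1 → suc b ≡ k → 1 ≤ r + b →
                     Dists (k + k + r) (k + r) (ed (k + r + b) 0) 0 1 b
farEdge-wrap-dists {b = suc b} z≤n refl _ =
  ⊓-exactʳ z≤n (cycDist-self _ 0) ,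
  ⊓-exactʳ (cycDist-≥ 1 (suc (suc b) + 0 + suc b) 1 (suc (b + b)) 1
             (inj₁ (ahead (solve (b ∷ [])))) (solve (b ∷ [])))
           (cycDist-short 1 0 1 (suc (suc (b + b))) (inj₁ (behind refl)) (solve (b ∷ []))) ,
  ⊓-exactˡ (cycDist-short (suc (suc b) + 0) (suc (suc b) + 0 + suc b) (suc b) 2
             (inj₁ (ahead refl)) (solve (b ∷ [])))
           (cycDist-≥ (suc (suc b) + 0) 0 (suc b) 1 1 (inj₁ (behind (solve (b ∷ [])))) (solve (b ∷ [])))
farEdge-wrap-dists {b = b} (s≤s z≤n) refl _ =
  ⊓-exactʳ z≤n (cycDist-self _ 0) ,
  ⊓-exactʳ (cycDist-≥ 1 (suc b + 1 + b) 1 (b + b) 1 (inj₁ (ahead (solve (b ∷ [])))) (solve (b ∷ [])))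
           (cycDist-short 1 0 1 (suc (b + b)) (inj₁ (behind refl)) (solve (b ∷ []))) ,
  ⊓-exactˡ (cycDist-short (suc b + 1) (suc b + 1 + b) b 3 (inj₁ (ahead refl)) (solve (b ∷ [])))
           (cycDist-≥ (suc b + 1) 0 b 2 1 (inj₁ (behind (solve (b ∷ [])))) (solve (b ∷ [])))

farEdge-dists : ∀ {k r j b} → r ≤ 1 → suc (suc j + b) ≡ k → 1 ≤ r + b →
                Dists (k + k + r) (k + r) (ed (k + r + b) (suc (k + r + b))) (suc j) (suc (suc j)) b
farEdge-dists {r = r} {j} {b} r≤1 refl 1≤r+b =
  ⊓-exactʳ (cycDist-≥ 0 (suc (suc j + b) + r + b) (suc j) (suc (b + b + r)) 1
             (inj₁ (ahead (solve (j ∷ b ∷ r ∷ [])))) (solve (j ∷ b ∷ r ∷ [])))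
           (cycDist-short 0 (suc (suc (suc j + b) + r + b)) (suc j) (suc (suc (b + b + r)))
             (inj₂ (ahead (solve (j ∷ b ∷ r ∷ [])))) (solve (j ∷ b ∷ r ∷ []))) ,
  ⊓-exactʳ (from-1 r≤1 1≤r+b)
           (cycDist-short 1 (suc (suc (suc j + b) + r + b)) (suc (suc j)) (b + b + r)
             (inj₂ (ahead (solve (j ∷ b ∷ r ∷ [])))) (solve (j ∷ b ∷ r ∷ []))) ,
  ⊓-exactˡ (cycDist-short (suc (suc j + b) + r) (suc (suc j + b) + r + b) b
             (suc (suc (suc (suc (j + j)))) + r) (inj₁ (ahead refl)) (solve (j ∷ b ∷ r ∷ [])))
           (cycDist-≥ (suc (suc j + b) + r) (suc (suc (suc j + b) + r + b)) b 1
             (suc (suc (suc (j + j))) + r)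
             (inj₁ (ahead (solve (j ∷ b ∷ r ∷ [])))) (solve (j ∷ b ∷ r ∷ [])))
  where
  from-1 : ∀ {r b} → r ≤ 1 → 1 ≤ r + b →
           suc (suc j) ≤ cycDist (suc (suc j + b) + suc (suc j + b) + r) 1 (suc (suc j + b) + r + b)
  from-1 {b = suc b} z≤n _ = cycDist-≥ 1 (suc (suc j + suc b) + 0 + suc b) (suc (suc j)) (suc (b + b)) 1
    (inj₁ (ahead (solve (j ∷ b ∷ [])))) (solve (j ∷ b ∷ []))
  from-1 {b = b} (s≤s z≤n) _ = cycDist-≥ 1 (suc (suc j + b) + 1 + b) (suc (suc j)) (b + b) 1
    (inj₁ (ahead (solve (j ∷ b ∷ [])))) (solve (j ∷ b ∷ []))

WellFormed : ℕ → Descriptor → Set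
WellFormed N (pt x) = x < N
WellFormed N (ed p q) = p < N × q < N × Succ N p q

Succ-step : ∀ {N p q} → q < N → suc p < N → Succ N p q → q ≡ suc p
Succ-step _ _ (inj₁ p+1≡q) = sym p+1≡q
Succ-step _ p+1<N (inj₂ (_ , p+1≡N)) = ⊥-elim (<-irrefl p+1≡N p+1<N)

Succ-wrap : ∀ {N p q} → q < N → suc p ≡ N → Succ N p q → q ≡ 0
Succ-wrap q<N p+1≡N (inj₁ refl) = ⊥-elim (<-irrefl p+1≡N q<N)
Succ-wrap _ _ (inj₂ (q≡0 , _)) = q≡0

far-length : ∀ {k r b j} → suc (k + r + b) + j ≡ k + k + r → suc (j + b) ≡ k
far-length {k} {r} {b} {j} eq = +-cancelˡ-≡ (k + r) (suc (j + b)) k (begin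
  k + r + suc (j + b)       ≡⟨ solve (k ∷ r ∷ b ∷ j ∷ []) ⟩
  suc (k + r + b) + j       ≡⟨ eq ⟩
  k + k + r                 ≡⟨ solve (k ∷ r ∷ []) ⟩
  k + r + k                 ∎)
  where open ≡-Reasoning

between-k-and-t : ∀ {k r x} → r ≤ 1 → k < x → x ≤ k + r → r ≡ 1 × x ≡ k + r
between-k-and-t {k} z≤n k<x x≤k+0 =
  ⊥-elim (<-irrefl refl (≤-trans k<x (≤-trans x≤k+0 (≤-reflexive (+-identityʳ k)))))
between-k-and-t {k} (s≤s z≤n) k<x x≤k+1 = refl , ≤-antisym x≤k+1 (≤-trans (≤-reflexive (+-comm k 1)) k<x)

≤1⇒≡0⊎≡1 : ∀ {r} → r ≤ 1 → r ≡ 0 ⊎ r ≡ 1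
≤1⇒≡0⊎≡1 z≤n = inj₁ refl
≤1⇒≡0⊎≡1 (s≤s z≤n) = inj₂ refl

half-positive : ∀ {k r} → r ≤ 1 → 3 ≤ k + k + r → 1 ≤ k
half-positive {zero} r≤1 3≤r with s≤s () ← ≤-trans 3≤r r≤1
half-positive {suc k} _ _ = s≤s z≤n

half-even : ∀ {k} → 3 ≤ k + k + 0 → 2 ≤ k
half-even {zero} ()
half-even {suc zero} (s≤s (s≤s ()))
half-even {suc (suc k)} _ = s≤s (s≤s z≤n)

antipode-edge-fits : ∀ {k} → 2 ≤ k → suc (k + 0 + 0) < k + k + 0
antipode-edge-fits {k} 2≤k rewrite +-identityʳ k | +-identityʳ k | +-identityʳ (k + k) = +-monoˡ-≤ k 2≤k

module ShapeDescriptors (k r : ℕ) (r≤1 : r ≤ 1) (3≤N : 3 ≤ k + k + r) where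
  open CycleShapes k r

  N : ℕ
  N = k + k + r

  r≡0⊎1 : r ≡ 0 ⊎ r ≡ 1
  r≡0⊎1 = ≤1⇒≡0⊎≡1 r≤1

  1≤k : 1 ≤ k
  1≤k = half-positive r≤1 3≤N

  r≡0⇒2≤k : r ≡ 0 → 2 ≤ k
  r≡0⇒2≤k r≡0 = half-even (subst (λ r → 3 ≤ k + k + r) r≡0 3≤N)

  t<N : t < N
  t<N = subst (suc t ≤_) (sym (+-assoc k k r)) (+-monoˡ-≤ t 1≤k)

  descriptor : Shape → Descriptor
  descriptor (onSide near point j _) = pt j
  descriptor (onSide far point zero _) = pt 0
  descriptor (onSide far point (suc _) b) = pt (t + b)
  descriptor (onSide near edge j _) = ed j (suc j)
  descriptor (onSide far edge zero b) = ed (t + b) 0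
  descriptor (onSide far edge (suc _) b) = ed (t + b) (suc (t + b))
  descriptor (antipode point) = pt t
  descriptor (antipode edge) = ed t (suc t)

  descriptor-kind : ∀ s → descriptorKind (descriptor s) ≡ shapeKind s
  descriptor-kind (onSide near point _ _) = refl
  descriptor-kind (onSide far point zero _) = refl
  descriptor-kind (onSide far point (suc _) _) = refl
  descriptor-kind (onSide near edge _ _) = refl
  descriptor-kind (onSide far edge zero _) = refl
  descriptor-kind (onSide far edge (suc _) _) = refl
  descriptor-kind (antipode point) = refl
  descriptor-kind (antipode edge) = refl

  descriptor-dists : ∀ s → Valid s → Dists N t (descriptor s) (h₀ s) (h₁ s) (hₜ s)
  descriptor-dists (onSide near point _ _) (v , 1≤j , r≤b) = nearPoint-dists r≤1 1≤j r≤b v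
  descriptor-dists (onSide far point zero _) (v , _) = subst (Dists N t (pt 0) 0 1) (sym v) (origin-dists 1≤k)
  descriptor-dists (onSide far point (suc _) _) (v , 1≤b) = farPoint-dists v 1≤b
  descriptor-dists (onSide near edge _ _) (v , _) = nearEdge-dists r≤1 v
  descriptor-dists (onSide far edge zero _) (v , 1≤r+b) = farEdge-wrap-dists r≤1 v 1≤r+b
  descriptor-dists (onSide far edge (suc _) _) (v , 1≤r+b) = farEdge-dists r≤1 v 1≤r+b
  descriptor-dists (antipode point) r≡1 =
    subst (λ r → Dists (k + k + r) (k + r) (pt (k + r)) k k 0) (sym r≡1) antipodePoint-dists
  descriptor-dists (antipode edge) r≡0 =
    subst (λ r → Dists (k + k + r) (k + r) (ed (k + r) (suc (k + r))) (pred k) (pred k) 0) (sym r≡0)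
          (antipodeEdge-dists (r≡0⇒2≤k r≡0))

  pointShape : ∀ x → x < N → Σ Shape λ s → Valid s × descriptor s ≡ pt x
  pointShape zero _ = onSide far point 0 k , (refl , 1≤k) , refl
  pointShape (suc y) x<N with suc y ≤? k
  ... | yes x≤k = onSide near point (suc y) (t ∸ suc y) ,
                  (m+[n∸m]≡n (≤-trans x≤k (m≤m+n k r)) , s≤s z≤n , subst (r ≤_) (sym (+-∸-comm r x≤k)) (m≤n+m r _)) ,
                  refl
  ... | no x≰k with suc y ≤? t
  ...   | yes x≤t with r≡1 , x≡t ← between-k-and-t r≤1 (≰⇒> x≰k) x≤t = antipode point , r≡1 , cong pt (sym x≡t)
  ...   | no x≰t with b , refl ← m≤n⇒∃[o]m+o≡n (s≤s⁻¹ (≰⇒> x≰t)) with j , x+j≡N ← m≤n⇒∃[o]m+o≡n x<N =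
    onSide far point (suc j) (suc b) ,
    (far-length (trans (cong (λ z → suc z + j) (+-suc t b)) x+j≡N) , s≤s z≤n) ,
    cong pt (+-suc t b)

  edgeShape : ∀ p q → p < N → q < N → Succ N p q → Σ Shape λ s → Valid s × descriptor s ≡ ed p q
  edgeShape p q p<N q<N succ with suc p ≤? t
  ... | yes p<t = onSide near edge p (t ∸ suc p) , (m+[n∸m]≡n p<t , tt) ,
                  cong (ed p) (sym (Succ-step q<N (≤-<-trans p<t t<N) succ))
  ... | no p≮t with b , refl ← m≤n⇒∃[o]m+o≡n (s≤s⁻¹ (≰⇒> p≮t)) with j , p+1+j≡N ← m≤n⇒∃[o]m+o≡n p<N =
    far-or-antipode r≡0⊎1 b j p+1+j≡N succ
    where
    beyond : ∀ b j → 1 ≤ r + b → suc (t + b) + j ≡ N → Succ N (t + b) q →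
          Σ Shape λ s → Valid s × descriptor s ≡ ed (t + b) q
    beyond b zero 1≤r+b p+1≡N succ =
      onSide far edge zero b , (far-length p+1≡N , 1≤r+b) ,
      cong (ed (t + b)) (sym (Succ-wrap q<N (trans (sym (+-identityʳ _)) p+1≡N) succ))
    beyond b (suc j) 1≤r+b p+2+j≡N succ =
      onSide far edge (suc j) b , (far-length p+2+j≡N , 1≤r+b) ,
      cong (ed (t + b)) (sym (Succ-step q<N (subst (suc (t + b) <_) p+2+j≡N (m<m+n _ (s≤s z≤n))) succ))
    far-or-antipode : r ≡ 0 ⊎ r ≡ 1 → ∀ b j → suc (t + b) + j ≡ N → Succ N (t + b) q →
                      Σ Shape λ s → Valid s × descriptor s ≡ ed (t + b) q
    far-or-antipode (inj₂ r≡1) b j eq succ = beyond b j (subst (λ r → 1 ≤ r + b) (sym r≡1) (s≤s z≤n)) eq succ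
    far-or-antipode (inj₁ r≡0) (suc b) j eq succ =
      beyond (suc b) j (≤-trans (s≤s z≤n) (m≤n+m (suc b) r)) eq succ
    far-or-antipode (inj₁ r≡0) zero j eq succ = antipode edge , r≡0 ,
      cong₂ ed (sym (+-identityʳ t)) (trans (cong suc (sym (+-identityʳ t))) (sym (Succ-step q<N t+1<N succ)))
      where
      t+1<N : suc (t + 0) < N
      t+1<N = subst (λ r → suc (k + r + 0) < k + k + r) (sym r≡0) (antipode-edge-fits (r≡0⇒2≤k r≡0))

  shapeOf : ∀ D → WellFormed N D → Σ Shape λ s → Valid s × descriptor s ≡ D
  shapeOf (pt x) x<N = pointShape x x<N
  shapeOf (ed p q) (p<N , q<N , succ) = edgeShape p q p<N q<N succ

  2≤t : 2 ≤ t
  2≤t with r≡0⊎1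
  ... | inj₁ r≡0 = ≤-trans (r≡0⇒2≤k r≡0) (m≤m+n k r)
  ... | inj₂ r≡1 = subst (λ r → 2 ≤ k + r) (sym r≡1) (subst (2 ≤_) (+-comm 1 k) (s≤s 1≤k))

  1<N : 1 < N
  1<N = ≤-trans 2≤t (<⇒≤ t<N)

  0<N : 0 < N
  0<N = ≤-trans (s≤s z≤n) (<⇒≤ 1<N)

-- Both coordinates: the landmarks and the upper bound

private
  cancel-equal : ∀ {a a' b b'} → a ≡ a' → a + b ≡ a' + b' → b ≡ b'
  cancel-equal {a} refl = +-cancelˡ-≡ a _ _

  cancel-suc : ∀ {a a' b b'} → a ≡ suc a' → a + b ≡ a' + b' → b' ≡ suc b
  cancel-suc {a' = a'} {b} {b'} refl eq = sym (+-cancelˡ-≡ a' (suc b) b' (trans (+-suc a' b) eq))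

  n≢suc : ∀ {m n} → m ≡ n → m ≡ suc n → ⊥
  n≢suc refl eq = 1+n≢n (sym eq)

  no-double-step : ∀ {m n} → m ≡ suc n → n ≡ suc m → ⊥
  no-double-step {m} refl eq = m≢1+n+m _ {1} eq

  not-both-edges : ∀ {p p'} → kind p ≡ edge → kind p' ≡ edge → kind p ≡ point ⊎ kind p' ≡ point → ⊥
  not-both-edges κ _ (inj₁ κ') with () ← trans (sym κ) κ'
  not-both-edges _ κ (inj₂ κ') with () ← trans (sym κ) κ'

only-same : ∀ {T p p'} → Outcome T p p' → d₀ p ≡ d₀ p' → d₁ p ≡ d₁ p' → T
only-same (same t _) _ _ = t
only-same (apart _ ne) _ e₁ = ⊥-elim (ne e₁)
only-same (point-edge _ _ f₀ _) e₀ _ = ⊥-elim (n≢suc e₀ f₀)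
only-same (edge-point _ _ f₀ _) e₀ _ = ⊥-elim (n≢suc (sym e₀) f₀)

-- The two equations come from the landmarks (1,0) and (0,1), and the kind hypotheses say that
-- a torus element is an edge in at most one coordinate.
combine-outcomes : ∀ {S T pX pX' pY pY'} → Outcome S pX pX' → Outcome T pY pY' →
          d₁ pX + d₀ pY ≡ d₁ pX' + d₀ pY' → d₀ pX + d₁ pY ≡ d₀ pX' + d₁ pY' →
          kind pX ≡ point ⊎ kind pY ≡ point → kind pX' ≡ point ⊎ kind pY' ≡ point → S × T
combine-outcomes (same s refl) oY A C _ _ = s , only-same oY (cancel-equal refl A) (cancel-equal refl C)
combine-outcomes {pX = pX} {pX'} {pY} (apart e₀ ne) oY A C _ _ with y₁ ← cancel-equal e₀ C with oY
... | same _ e =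
  ⊥-elim (ne (+-cancelʳ-≡ (d₀ pY) (d₁ pX) (d₁ pX') (trans A (cong (d₁ pX' +_) (sym (cong d₀ e))))))
... | apart _ ne' = ⊥-elim (ne' y₁)
... | point-edge _ _ _ f₁ = ⊥-elim (n≢suc (sym y₁) f₁)
... | edge-point _ _ _ f₁ = ⊥-elim (n≢suc y₁ f₁)
combine-outcomes {pX' = pX'} {pY} {pY'} (point-edge _ κX' e₀ e₁) oY A C _ ok'
  with y₁ ← cancel-suc {b = d₁ pY} {d₁ pY'} e₀ C | y₀ ← cancel-suc {b = d₀ pY'} {d₀ pY} e₁ (sym A) with oY
... | same _ e = ⊥-elim (n≢suc (sym (cong d₁ e)) y₁)
... | apart f₀ _ = ⊥-elim (n≢suc f₀ y₀)
... | point-edge _ κY' _ _ = ⊥-elim (not-both-edges {pX'} {pY'} κX' κY' ok')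
... | edge-point _ _ f₀ _ = ⊥-elim (no-double-step y₀ f₀)
combine-outcomes {pX = pX} {pY = pY} {pY'} (edge-point κX _ e₀ e₁) oY A C ok _
  with y₁ ← cancel-suc {b = d₁ pY'} {d₁ pY} e₀ (sym C) | y₀ ← cancel-suc {b = d₀ pY} {d₀ pY'} e₁ A with oY
... | same _ e = ⊥-elim (n≢suc (cong d₁ e) y₁)
... | apart f₀ _ = ⊥-elim (n≢suc (sym f₀) y₀)
... | point-edge _ _ f₀ _ = ⊥-elim (no-double-step f₀ y₀)
... | edge-point κY _ _ _ = ⊥-elim (not-both-edges {pX} {pY} κX κY ok)

CycAdj⇒Succ : ∀ {N} {a b : Fin N} → CycAdj N a b → Succ N (toℕ a) (toℕ b) ⊎ Succ N (toℕ b) (toℕ a)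
CycAdj⇒Succ (inj₁ e) = inj₁ (inj₁ e)
CycAdj⇒Succ (inj₂ (inj₁ e)) = inj₂ (inj₁ e)
CycAdj⇒Succ (inj₂ (inj₂ (inj₁ e))) = inj₂ (inj₂ e)
CycAdj⇒Succ (inj₂ (inj₂ (inj₂ e))) = inj₁ (inj₂ e)

orientedEdge : ∀ {N} {a b : Fin N} → Succ N (toℕ a) (toℕ b) ⊎ Succ N (toℕ b) (toℕ a) → Descriptor
orientedEdge {a = a} {b} (inj₁ _) = ed (toℕ a) (toℕ b)
orientedEdge {a = a} {b} (inj₂ _) = ed (toℕ b) (toℕ a)

edgeDescriptor : ∀ {N} {a b : Fin N} → CycAdj N a b → Descriptor
edgeDescriptor adj = orientedEdge (CycAdj⇒Succ adj)

orientedEdge-wf : ∀ {N} {a b : Fin N} o → WellFormed N (orientedEdge {N} {a} {b} o)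
orientedEdge-wf {a = a} {b} (inj₁ s) = toℕ<n a , toℕ<n b , s
orientedEdge-wf {a = a} {b} (inj₂ s) = toℕ<n b , toℕ<n a , s

orientedEdge-dist : ∀ {N} {a b : Fin N} o c →
                    dist₁ N c (orientedEdge {N} {a} {b} o) ≡ cycDist N c (toℕ a) ⊓ cycDist N c (toℕ b)
orientedEdge-dist (inj₁ _) c = refl
orientedEdge-dist {N} {a} {b} (inj₂ _) c = ⊓-comm (cycDist N c (toℕ b)) _

orientedEdge-kind : ∀ {N} {a b : Fin N} o → descriptorKind (orientedEdge {N} {a} {b} o) ≡ edge
orientedEdge-kind (inj₁ _) = refl
orientedEdge-kind (inj₂ _) = refl

ed-injective : ∀ {p q p' q'} → ed p q ≡ ed p' q' → p ≡ p' × q ≡ q'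
ed-injective refl = refl , refl

orientedEdge-injective : ∀ {N} {a b a' b' : Fin N} o o' →
                         orientedEdge {N} {a} {b} o ≡ orientedEdge {N} {a'} {b'} o' →
                         (a ≡ a' × b ≡ b') ⊎ (a ≡ b' × b ≡ a')
orientedEdge-injective (inj₁ _) (inj₁ _) eq with e₁ , e₂ ← ed-injective eq = inj₁ (toℕ-injective e₁ , toℕ-injective e₂)
orientedEdge-injective (inj₁ _) (inj₂ _) eq with e₁ , e₂ ← ed-injective eq = inj₂ (toℕ-injective e₁ , toℕ-injective e₂)
orientedEdge-injective (inj₂ _) (inj₁ _) eq with e₁ , e₂ ← ed-injective eq = inj₂ (toℕ-injective e₂ , toℕ-injective e₁)
orientedEdge-injective (inj₂ _) (inj₂ _) eq with e₁ , e₂ ← ed-injective eq = inj₁ (toℕ-injective e₂ , toℕ-injective e₁)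

module TorusElements (m n : ℕ) where
  open Graph (TorusAdj m n)
  open ElementDistance TorusAdj-sym (torusDist m n) (torusDist-isDistance m n)

  projX : Elem → Descriptor
  projX (inj₁ (i , _)) = pt (toℕ i)
  projX (inj₂ (_ , _ , inj₁ (adj , _))) = edgeDescriptor adj
  projX (inj₂ ((i , _) , _ , inj₂ _)) = pt (toℕ i)

  projY : Elem → Descriptor
  projY (inj₁ (_ , j)) = pt (toℕ j)
  projY (inj₂ ((_ , j) , _ , inj₁ _)) = pt (toℕ j)
  projY (inj₂ (_ , _ , inj₂ (_ , adj))) = edgeDescriptor adj

  projX-wf : ∀ x → WellFormed m (projX x)
  projX-wf (inj₁ (i , _)) = toℕ<n i
  projX-wf (inj₂ (_ , _ , inj₁ (adj , _))) = orientedEdge-wf (CycAdj⇒Succ adj)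
  projX-wf (inj₂ ((i , _) , _ , inj₂ _)) = toℕ<n i

  projY-wf : ∀ x → WellFormed n (projY x)
  projY-wf (inj₁ (_ , j)) = toℕ<n j
  projY-wf (inj₂ ((_ , j) , _ , inj₁ _)) = toℕ<n j
  projY-wf (inj₂ (_ , _ , inj₂ (_ , adj))) = orientedEdge-wf (CycAdj⇒Succ adj)

  at-most-one-edge : ∀ x → descriptorKind (projX x) ≡ point ⊎ descriptorKind (projY x) ≡ point
  at-most-one-edge (inj₁ _) = inj₁ refl
  at-most-one-edge (inj₂ (_ , _ , inj₁ _)) = inj₂ refl
  at-most-one-edge (inj₂ (_ , _ , inj₂ _)) = inj₁ refl

  elemDist-proj : ∀ a b x → elemDist (a , b) x ≡ dist₁ m (toℕ a) (projX x) + dist₁ n (toℕ b) (projY x)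
  elemDist-proj a b (inj₁ _) = refl
  elemDist-proj a b (inj₂ ((i , j) , _ , inj₁ (adj , refl))) =
    trans (sym (+-distribʳ-⊓ (cycDist n (toℕ b) (toℕ j)) _ _))
          (cong (_+ cycDist n (toℕ b) (toℕ j)) (sym (orientedEdge-dist (CycAdj⇒Succ adj) (toℕ a))))
  elemDist-proj a b (inj₂ ((i , j) , _ , inj₂ (refl , adj))) =
    trans (sym (+-distribˡ-⊓ (cycDist m (toℕ a) (toℕ i)) _ _))
          (cong (cycDist m (toℕ a) (toℕ i) +_) (sym (orientedEdge-dist (CycAdj⇒Succ adj) (toℕ b))))

  private
    pt-injective : ∀ {N} {a b : Fin N} → pt (toℕ a) ≡ pt (toℕ b) → a ≡ b
    pt-injective eq = toℕ-injective (cong (λ { (pt x) → x ; (ed p _) → p }) eq)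

    edge≢pt : ∀ {N} {a b : Fin N} (adj : CycAdj N a b) x → edgeDescriptor adj ≢ pt x
    edge≢pt adj x eq with () ← trans (sym (orientedEdge-kind (CycAdj⇒Succ adj))) (cong descriptorKind eq)

  proj-injective : ∀ x y → projX x ≡ projX y → projY x ≡ projY y → SameElem x y
  proj-injective (inj₁ _) (inj₁ _) ex ey = cong₂ _,_ (pt-injective ex) (pt-injective ey)
  proj-injective (inj₁ _) (inj₂ (_ , _ , inj₁ (adj , _))) ex _ = edge≢pt adj _ (sym ex)
  proj-injective (inj₁ _) (inj₂ (_ , _ , inj₂ (_ , adj))) _ ey = edge≢pt adj _ (sym ey)
  proj-injective (inj₂ (_ , _ , inj₁ (adj , _))) (inj₁ _) ex _ = edge≢pt adj _ ex
  proj-injective (inj₂ (_ , _ , inj₂ (_ , adj))) (inj₁ _) _ ey = edge≢pt adj _ ey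
  proj-injective (inj₂ (_ , _ , inj₁ (adj , _))) (inj₂ (_ , _ , inj₂ _)) ex _ = ⊥-elim (edge≢pt adj _ ex)
  proj-injective (inj₂ (_ , _ , inj₂ (_ , adj))) (inj₂ (_ , _ , inj₁ _)) _ ey = ⊥-elim (edge≢pt adj _ ey)
  proj-injective (inj₂ (_ , _ , inj₁ (adj , refl))) (inj₂ (_ , _ , inj₁ (adj' , refl))) ex ey
    with refl ← pt-injective ey with orientedEdge-injective (CycAdj⇒Succ adj) (CycAdj⇒Succ adj') ex
  ... | inj₁ (refl , refl) = inj₁ (refl , refl)
  ... | inj₂ (refl , refl) = inj₂ (refl , refl)
  proj-injective (inj₂ (_ , _ , inj₂ (refl , adj))) (inj₂ (_ , _ , inj₂ (refl , adj'))) ex ey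
    with refl ← pt-injective ex with orientedEdge-injective (CycAdj⇒Succ adj) (CycAdj⇒Succ adj') ey
  ... | inj₁ (refl , refl) = inj₁ (refl , refl)
  ... | inj₂ (refl , refl) = inj₂ (refl , refl)

-- Two landmarks with the same first coordinate give the fibre equation of the second.
fibre-from : ∀ a b c a' b' c' → a + b ≡ a' + b' → a + c ≡ a' + c' → b + c' ≡ b' + c
fibre-from a b c a' b' c' e₁ e₂ = +-cancelʳ-≡ (a + a') (b + c') (b' + c) (begin
  b + c' + (a + a')       ≡⟨ solve (a ∷ b ∷ c' ∷ a' ∷ []) ⟩
  (a + b) + (a' + c')     ≡⟨ cong₂ _+_ e₁ (sym e₂) ⟩
  (a' + b') + (a + c)     ≡⟨ solve (a ∷ b' ∷ c ∷ a' ∷ []) ⟩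
  b' + c + (a + a')       ∎)
  where open ≡-Reasoning

rewrite-sum : ∀ {a b a' b' p q p' q'} → a ≡ p → b ≡ q → a' ≡ p' → b' ≡ q' →
              a + b ≡ a' + b' → p + q ≡ p' + q'
rewrite-sum refl refl refl refl e = e


module TorusLandmarks (km rm kn rn : ℕ) (rm≤1 : rm ≤ 1) (rn≤1 : rn ≤ 1)
                      (3≤M : 3 ≤ km + km + rm) (3≤N : 3 ≤ kn + kn + rn) where
  private
    M = km + km + rm
    N = kn + kn + rn
    module X = ShapeDescriptors km rm rm≤1 3≤M
    module Y = ShapeDescriptors kn rn rn≤1 3≤N
    module SX = CycleShapes km rm
    module SY = CycleShapes kn rn
    tm = km + rm
    tn = kn + rn
  open Graph (TorusAdj M N)
  open ElementDistance TorusAdj-sym (torusDist M N) (torusDist-isDistance M N)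
  open TorusElements M N

  private
    shape-kinds : ∀ sX sY → descriptorKind (X.descriptor sX) ≡ point ⊎ descriptorKind (Y.descriptor sY) ≡ point →
                  shapeKind sX ≡ point ⊎ shapeKind sY ≡ point
    shape-kinds sX sY (inj₁ κ) = inj₁ (trans (sym (X.descriptor-kind sX)) κ)
    shape-kinds sX sY (inj₂ κ) = inj₂ (trans (sym (Y.descriptor-kind sY)) κ)

  coordinates-determined : ∀ {DX DX' DY DY'} →
    WellFormed M DX → WellFormed M DX' → WellFormed N DY → WellFormed N DY' →
    descriptorKind DX ≡ point ⊎ descriptorKind DY ≡ point →
    descriptorKind DX' ≡ point ⊎ descriptorKind DY' ≡ point →
    dist₁ M 1 DX + dist₁ N 0 DY ≡ dist₁ M 1 DX' + dist₁ N 0 DY' →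
    dist₁ M 1 DX + dist₁ N tn DY ≡ dist₁ M 1 DX' + dist₁ N tn DY' →
    dist₁ M 0 DX + dist₁ N 1 DY ≡ dist₁ M 0 DX' + dist₁ N 1 DY' →
    dist₁ M tm DX + dist₁ N 1 DY ≡ dist₁ M tm DX' + dist₁ N 1 DY' →
    DX ≡ DX' × DY ≡ DY'
  coordinates-determined wfX wfX' wfY wfY' ok ok' A B C E
    with sX , vX , refl ← X.shapeOf _ wfX | sX' , vX' , refl ← X.shapeOf _ wfX'
       | sY , vY , refl ← Y.shapeOf _ wfY | sY' , vY' , refl ← Y.shapeOf _ wfY'
    with x₀ , x₁ , xₜ ← X.descriptor-dists sX vX | x₀' , x₁' , xₜ' ← X.descriptor-dists sX' vX'
       | y₀ , y₁ , yₜ ← Y.descriptor-dists sY vY | y₀' , y₁' , yₜ' ← Y.descriptor-dists sY' vY'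
    with A' ← rewrite-sum x₁ y₀ x₁' y₀' A | B' ← rewrite-sum x₁ yₜ x₁' yₜ' B
       | C' ← rewrite-sum x₀ y₁ x₀' y₁' C | E' ← rewrite-sum xₜ y₁ xₜ' y₁' E
    with refl , refl ← combine-outcomes
           (SX.fibre-outcome X.r≡0⊎1 X.1≤k X.r≡0⇒2≤k sX sX' vX vX'
              (fibre-from (SY.h₁ sY) (SX.h₀ sX) (SX.hₜ sX) (SY.h₁ sY') (SX.h₀ sX') (SX.hₜ sX')
                 (trans (+-comm _ (SX.h₀ sX)) (trans C' (+-comm (SX.h₀ sX') _)))
                 (trans (+-comm _ (SX.hₜ sX)) (trans E' (+-comm (SX.hₜ sX') _)))))
           (SY.fibre-outcome Y.r≡0⊎1 Y.1≤k Y.r≡0⇒2≤k sY sY' vY vY'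
              (fibre-from (SX.h₁ sX) (SY.h₀ sY) (SY.hₜ sY) (SX.h₁ sX') (SY.h₀ sY') (SY.hₜ sY') A' B'))
           A' C' (shape-kinds sX sY ok) (shape-kinds sX' sY' ok')
    = refl , refl

  vertexAt : ∀ {i j} → i < M → j < N → Fin M × Fin N
  vertexAt i<M j<N = fromℕ< i<M , fromℕ< j<N

  landmarks : List (Fin M × Fin N)
  landmarks = vertexAt X.1<N Y.0<N ∷ vertexAt X.1<N Y.t<N ∷ vertexAt X.0<N Y.1<N ∷ vertexAt X.t<N Y.1<N ∷ []

  landmark-equation : ∀ {i j} (i<M : i < M) (j<N : j < N) x y →
    elemDist (vertexAt i<M j<N) x ≡ elemDist (vertexAt i<M j<N) y →
    dist₁ M i (projX x) + dist₁ N j (projY x) ≡ dist₁ M i (projX y) + dist₁ N j (projY y)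
  landmark-equation i<M j<N x y eq = trans (sym (at x)) (trans eq (at y))
    where
    at : ∀ x → elemDist (vertexAt i<M j<N) x ≡ dist₁ M _ (projX x) + dist₁ N _ (projY x)
    at x = trans (elemDist-proj _ _ x)
                 (cong₂ (λ a b → dist₁ M a (projX x) + dist₁ N b (projY x)) (toℕ-fromℕ< i<M) (toℕ-fromℕ< j<N))

  landmarks-separate : ∀ x y → All (λ w → elemDist w x ≡ elemDist w y) landmarks → SameElem x y
  landmarks-separate x y (eA All.∷ eB All.∷ eC All.∷ eE All.∷ All.[])
    with eX , eY ← coordinates-determined (projX-wf x) (projX-wf y) (projY-wf x) (projY-wf y)
                     (at-most-one-edge x) (at-most-one-edge y)
                     (landmark-equation X.1<N Y.0<N x y eA) (landmark-equation X.1<N Y.t<N x y eB)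
                     (landmark-equation X.0<N Y.1<N x y eC) (landmark-equation X.t<N Y.1<N x y eE)
    = proj-injective x y eX eY

  private
    fromℕ<-≢ : ∀ {K a b} (a<K : a < K) (b<K : b < K) → a ≢ b → fromℕ< a<K ≢ fromℕ< b<K
    fromℕ<-≢ a<K b<K a≢b eq = a≢b (trans (sym (toℕ-fromℕ< a<K)) (trans (cong toℕ eq) (toℕ-fromℕ< b<K)))

    differ₁ : ∀ {i i' j j'} (i<M : i < M) (i'<M : i' < M) (j<N : j < N) (j'<N : j' < N) →
              i ≢ i' → vertexAt i<M j<N ≢ vertexAt i'<M j'<N
    differ₁ i<M i'<M _ _ i≢i' eq = fromℕ<-≢ i<M i'<M i≢i' (,-injectiveˡ eq)

    differ₂ : ∀ {i i' j j'} (i<M : i < M) (i'<M : i' < M) (j<N : j < N) (j'<N : j' < N) →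
              j ≢ j' → vertexAt i<M j<N ≢ vertexAt i'<M j'<N
    differ₂ _ _ j<N j'<N j≢j' eq = fromℕ<-≢ j<N j'<N j≢j' (,-injectiveʳ eq)

  landmarks-unique : Unique landmarks
  landmarks-unique =
    (differ₂ X.1<N X.1<N Y.0<N Y.t<N (<⇒≢ (≤-trans (s≤s z≤n) Y.2≤t)) All.∷
     differ₁ X.1<N X.0<N Y.0<N Y.1<N (λ ()) All.∷
     differ₂ X.1<N X.t<N Y.0<N Y.1<N (λ ()) All.∷ All.[]) AllPairs.∷
    (differ₁ X.1<N X.0<N Y.t<N Y.1<N (λ ()) All.∷
     differ₂ X.1<N X.t<N Y.t<N Y.1<N (≢-sym (<⇒≢ Y.2≤t)) All.∷ All.[]) AllPairs.∷
    (differ₁ X.0<N X.t<N Y.1<N Y.1<N (<⇒≢ (≤-trans (s≤s z≤n) X.2≤t)) All.∷ All.[]) AllPairs.∷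
    All.[] AllPairs.∷ AllPairs.[]

  landmarks-resolving : MixedResolving landmarks
  landmarks-resolving = resolving-if-separating landmarks landmarks-separate

halving : ∀ m → ∃ λ k → ∃ λ r → r ≤ 1 × k + k + r ≡ m
halving zero = 0 , 0 , z≤n , refl
halving (suc zero) = 0 , 1 , s≤s z≤n , refl
halving (suc (suc m)) with k , r , r≤1 , refl ← halving m = suc k , r , r≤1 , solve (k ∷ r ∷ [])

torus-resolving-set : ∀ m n → 3 ≤ m → 3 ≤ n →
  Σ (List (Fin m × Fin n)) λ S → Unique S × Graph.MixedResolving (TorusAdj m n) S × length S ≡ 4
torus-resolving-set m n 3≤m 3≤n with km , rm , rm≤1 , refl ← halving m | kn , rn , rn≤1 , refl ← halving n =
  landmarks , landmarks-unique , landmarks-resolving , refl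
  where open TorusLandmarks km rm kn rn rm≤1 rn≤1 3≤m 3≤n

torus-resolving-size : ∀ m n → 3 ≤ m → 3 ≤ n → ∀ S → Graph.MixedResolving (TorusAdj m n) S → 4 ≤ length S
torus-resolving-size (suc (suc (suc P))) (suc (suc (suc Q))) (s≤s (s≤s (s≤s _))) (s≤s (s≤s (s≤s _))) =
  TorusNeighbours.torus-resolving⇒4≤length P Q

theorem5 : (m n : ℕ) → 3 ≤ m → 3 ≤ n →
    Graph.MixedMetricDim≡ (TorusAdj m n) 4
theorem5 m n 3≤m 3≤n = torus-resolving-set m n 3≤m 3≤n , λ S _ → torus-resolving-size m n 3≤m 3≤n S
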